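{- Let $G$ be a base graph on $n$ vertices with average degree $d^{\mathrm{av}}(G)\ge 1$, and consider $T=n$ i.i.d. uniform arrivals from $E(G)$. Then $\mathrm{OPT}(G,n)\ge 2\rho^*(G)/d^{\mathrm{av}}(G)$ and $\mathrm{OPT}(G,n)=\Omega\big(\log n/\log(d^{\mathrm{av}}(G)\cdot\log n)\big)$.
   Context: Given a base graph $G=(V,E)$ on $n$ vertices, $T$ edges $e_1,\dots,e_T$ are drawn independently and uniformly at random from $E$ (with replacement) forming a multigraph $G'$; $\mathrm{OPT}(G,T)$ is the expectation of the minimum, over all orientations of the edges of $G'$, of the maximum in-degree (load). For a multigraph $H=(V_H,E_H)$, $\rho(H)=|E_H|/|V_H|$ (edges counted with multiplicity) and $\rho^*(H)=\max_{\emptyset\ne S\subseteq V_H}\rho(H[S])$, where $H[S]$ is the induced subgraph. $d^{\mathrm{av}}(G)=2|E|/n$. -}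

module Defs where

open import Data.Bool using (Bool; true; false; _∧_; if_then_else_)
open import Data.Nat as ℕ using (ℕ; zero; suc; _<ᵇ_; _^_)
open import Data.Integer using (+_)
open import Data.Fin as Fin using (Fin; toℕ)
open import Data.Product using (_×_; _,_; proj₁; proj₂)
open import Data.List as List using (List; []; _∷_; filterᵇ; length; allFin; cartesianProduct; foldr; concatMap)
open import Data.Nat.ListAction using (sum)
open import Data.Vec as Vec using (Vec; []; _∷_)
open import Data.Rational as ℚ using (ℚ; 0ℚ)
open import Relation.Binary.PropositionalEquality using (_≡_)
open import Relation.Nullary using (does)
open import Data.Nat.Logarithm using (⌊log₂_⌋)
open import Data.Nat.DivMod using (_/_)

record Graph (n : ℕ) : Set where
  field
    adj        : Fin n → Fin n → Bool
    adj-sym    : ∀ i j → adj i j ≡ adj j i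
    adj-irrefl : ∀ i → adj i i ≡ false
open Graph public

edges : ∀ {n} → Graph n → List (Fin n × Fin n)
edges {n} G = filterᵇ (λ p → (toℕ (proj₁ p) <ᵇ toℕ (proj₂ p)) ∧ adj G (proj₁ p) (proj₂ p))
                      (cartesianProduct (allFin n) (allFin n))

numE : ∀ {n} → Graph n → ℕ
numE G = length (edges G)

-- a / b as a rational; the b = 0 case is a convention (0) never used under the hypotheses.
frac : ℕ → ℕ → ℚ
frac a zero    = 0ℚ
frac a (suc b) = (+ a) ℚ./ suc b

allVecs : ∀ {A : Set} → List A → (T : ℕ) → List (Vec A T)
allVecs xs zero    = [] ∷ []
allVecs xs (suc T) = concatMap (λ x → List.map (x ∷_) (allVecs xs T)) xs

-- Orientation of an edge (u , v): true means oriented towards v, false towards u.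
heads : ∀ {n T} → Vec (Fin n × Fin n) T → Vec Bool T → List (Fin n)
heads es o = Vec.toList (Vec.zipWith (λ e b → if b then proj₂ e else proj₁ e) es o)

inDeg : ∀ {n} → List (Fin n) → Fin n → ℕ
inDeg hs w = length (filterᵇ (λ x → does (x Fin.≟ w)) hs)

maxLoad : ∀ {n} → List (Fin n) → ℕ
maxLoad {n} hs = foldr ℕ._⊔_ 0 (List.map (inDeg hs) (allFin n))

-- minimum over all 2^T orientations of the max load. (Every max load is ≤ T and
-- there is at least one orientation, so starting the fold at T yields the true minimum.)
minMaxLoad : ∀ {n T} → Vec (Fin n × Fin n) T → ℕ
minMaxLoad {n} {T} es =
  foldr ℕ._⊓_ T (List.map (λ o → maxLoad (heads es o)) (allVecs (true ∷ false ∷ []) T))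

-- OPT(G,T): expectation over the |E|^T equally likely arrival sequences
-- (e_1..e_T drawn i.i.d. uniformly from E, with replacement).
OPT : ∀ {n} → Graph n → ℕ → ℚ
OPT G T =
  frac (sum (List.map (λ a → minMaxLoad (Vec.map (List.lookup (edges G)) a))
                      (allVecs (allFin (numE G)) T)))
       (numE G ^ T)

size : ∀ {n} → Vec Bool n → ℕ
size S = length (filterᵇ (λ b → b) (Vec.toList S))

edgesIn : ∀ {n} → Graph n → Vec Bool n → ℕ
edgesIn G S = length (filterᵇ (λ p → Vec.lookup S (proj₁ p) ∧ Vec.lookup S (proj₂ p)) (edges G))

rho : ∀ {n} → Graph n → Vec Bool n → ℚ
rho G S = frac (edgesIn G S) (size S)

nonempty : ∀ {n} → Vec Bool n → Bool
nonempty S = 0 <ᵇ size S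

-- ρ*(G) = max over nonempty S of ρ(G[S]) (all values are ≥ 0, so folding from 0 is exact
-- whenever n ≥ 1).
rhoStar : ∀ {n} → Graph n → ℚ
rhoStar {n} G = foldr ℚ._⊔_ 0ℚ
  (List.map (rho G) (filterᵇ nonempty (allVecs (true ∷ false ∷ []) n)))

dav : ∀ {n} → Graph n → ℚ
dav {n} G = frac (2 ℕ.* numE G) n

-- floor of log₂ (d^av(G) · ⌊log₂ n⌋), used to render log(d^av · log n)
logDavLog : ∀ {n} → Graph n → ℕ
logDavLog {zero}  G = 0
logDavLog {suc k} G = ⌊log₂ ((2 ℕ.* numE G ℕ.* ⌊log₂ (suc k) ⌋) / suc k) ⌋

lg : ℕ → ℕ
lg n = ⌊log₂ n ⌋

-- Expectations over the |E|^T equally likely arrival sequences are sums over all sequences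
-- (allVecs), so every probabilistic step below is a counting identity or inequality.
--
-- Density: in any orientation the arrivals with both ends in a vertex set S raise loads inside S,
-- so the maximum load is at least (arrivals inside S)/|S|; by linearity n uniform arrivals put
-- n·e(S)/|E| of them inside S on average.
--
-- Logarithmic bound: an edge arriving k times forces maximum load ⌈k/2⌉, as its two endpoints
-- share its k copies. Cut the n arrivals into k blocks of m = ⌊n/k⌋ and let Z be the sum over
-- edges x of the product over the blocks of the number of copies of x in the block, so Z > 0 when
-- some edge arrives in every block. The blocks are independent, so the first two moments of Z
-- factor, and the second-moment (Cauchy–Schwarz) inequality gives P(Z > 0) ≥ 1/2 as soon as
-- (|E| + m)^k ≤ |E|·m^k. This holds for k = ⌊lg n / 6D⌋ with D = ⌊log₂(d^av·lg n)⌋, giving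
-- OPT ≥ k/4; when lg n ≤ 12D the trivial bound OPT ≥ 1 suffices.
module Submission where

open import Data.Bool using (Bool; true; false; T; _∧_; _∨_; if_then_else_)
open import Data.Bool.Properties using (∨-zeroʳ)
open import Data.Empty using (⊥-elim)
open import Data.Fin as Fin using (Fin)
import Data.Integer as ℤ
open import Data.Integer.Properties using (pos-*)
open import Data.List as List using (List; []; _∷_; _++_; length; allFin; concatMap; filterᵇ; foldr)
open import Data.List.Membership.Propositional using (_∈_)
open import Data.List.Membership.Propositional.Properties using (∈-allFin; ∈-filter⁺)
open import Data.List.Properties using (length-tabulate; map-tabulate; length-filter)
open import Data.List.Relation.Unary.Any using (here; there)
open import Data.Nat as ℕ
  using (ℕ; zero; suc; _+_; _*_; _∸_; _^_; _≤_; _<_; _≤?_; _<ᵇ_; z≤n; s≤s; NonZero; ⌊_/2⌋; ⌈_/2⌉)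
open import Data.Nat.DivMod using (_/_; _%_; m≡m%n+[m/n]*n; m%n<n; m*n/n≡m; /-monoˡ-≤; m/n≤m; m/n*n≤m; m≥n⇒m/n>0)
open import Data.Nat.ListAction using (sum)
open import Data.Nat.Logarithm using (⌊log₂_⌋; ⌊log₂⌋-mono-≤; ⌊log₂[2^n]⌋≡n)
open import Data.Nat.Logarithm.Core using (⌊log2⌋)
open import Data.Nat.Properties
open import Data.Nat.Solver using (module +-*-Solver)
open import Data.Product using (Σ; ∃-syntax; _×_; _,_; proj₁; proj₂)
open import Data.Rational as ℚ using (ℚ; 0ℚ; 1ℚ)
open import Data.Rational.Properties as ℚP using (toℚᵘ-fromℚᵘ; toℚᵘ-homo-*; toℚᵘ-cancel-≤; toℚᵘ-mono-≤)
open import Data.Rational.Unnormalised as ℚᵘ using (mkℚᵘ)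
import Data.Rational.Unnormalised.Properties as ℚᵘP
open import Data.Sum using (_⊎_; inj₁; inj₂)
open import Data.Vec as Vec using (Vec; []; _∷_)
open import Data.Vec.Properties using (toList-++; toList-map; take++drop≡id; ++-injectiveˡ; ++-injectiveʳ)
open import Function using (_∘_)
open import Induction.WellFounded using (Acc; acc)
open import Relation.Binary.PropositionalEquality
open import Relation.Nullary using (¬_; does; yes; no)
open import Relation.Nullary.Decidable using (dec-true; T?)

open import Defs

open +-*-Solver using (solve; _:+_; _:*_; _:=_; con)
open import Algebra.Properties.CommutativeSemigroup *-commutativeSemigroup using (x∙yz≈y∙xz; xy∙z≈xz∙y; x∙yz≈xz∙y)

0<m*n : ∀ {m n} → 0 < m → 0 < n → 0 < m * n
0<m*n {suc m} {suc n} _ _ = s≤s z≤n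

0<m*n⇒0<m : ∀ m {n} → 0 < m * n → 0 < m
0<m*n⇒0<m (suc m) _ = s≤s z≤n

0<m*n⇒0<n : ∀ m {n} → 0 < m * n → 0 < n
0<m*n⇒0<n m {n} pos = 0<m*n⇒0<m n (subst (0 <_) (*-comm m n) pos)

m≤m*m : ∀ m → m ≤ m * m
m≤m*m zero      = z≤n
m≤m*m m@(suc _) = m≤m*n m m

^-distrib-* : ∀ m n k → (m * n) ^ k ≡ m ^ k * n ^ k
^-distrib-* m n zero    = refl
^-distrib-* m n (suc k) =
  trans (cong (m * n *_) (^-distrib-* m n k)) ([m*n]*[o*p]≡[m*o]*[n*p] m n (m ^ k) (n ^ k))

private
  2*m*[m+d]≤m*m+[m+d]*[m+d] : ∀ m d → 2 * m * (m + d) ≤ m * m + (m + d) * (m + d)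
  2*m*[m+d]≤m*m+[m+d]*[m+d] m d = subst (2 * m * (m + d) ≤_) (expand m d) (m≤m+n _ (d * d))
    where
    expand : ∀ m d → 2 * m * (m + d) + d * d ≡ m * m + (m + d) * (m + d)
    expand = solve 2 (λ m d → con 2 :* m :* (m :+ d) :+ d :* d := m :* m :+ (m :+ d) :* (m :+ d)) refl

2*m*n≤m*m+n*n : ∀ m n → 2 * m * n ≤ m * m + n * n
2*m*n≤m*m+n*n m n with ≤-total m n
... | inj₁ m≤n = subst (λ n → 2 * m * n ≤ m * m + n * n) (m+[n∸m]≡n m≤n) (2*m*[m+d]≤m*m+[m+d]*[m+d] m (n ∸ m))
... | inj₂ n≤m = subst₂ _≤_ (xy∙z≈xz∙y 2 n m) (+-comm (n * n) (m * m))
                   (subst (λ m → 2 * n * m ≤ n * n + m * m) (m+[n∸m]≡n n≤m) (2*m*[m+d]≤m*m+[m+d]*[m+d] n (m ∸ n)))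

∑ : {A : Set} → List A → (A → ℕ) → ℕ
∑ xs f = sum (List.map f xs)

infix 5 ∑
syntax ∑ xs (λ x → e) = ∑[ x ∈ xs ] e

𝟙 : Bool → ℕ
𝟙 true  = 1
𝟙 false = 0

𝟙[x∧y]≤𝟙x : ∀ x y → 𝟙 (x ∧ y) ≤ 𝟙 x
𝟙[x∧y]≤𝟙x true  true  = ≤-refl
𝟙[x∧y]≤𝟙x true  false = z≤n
𝟙[x∧y]≤𝟙x false y     = z≤n

𝟙[x∧y]≤𝟙y : ∀ x y → 𝟙 (x ∧ y) ≤ 𝟙 y
𝟙[x∧y]≤𝟙y true  y = ≤-refl
𝟙[x∧y]≤𝟙y false y = z≤n

module _ {A : Set} where

  ∑-++ : ∀ xs ys (f : A → ℕ) → ∑ (xs ++ ys) f ≡ ∑ xs f + ∑ ys f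
  ∑-++ []       ys f = refl
  ∑-++ (x ∷ xs) ys f = trans (cong (f x +_) (∑-++ xs ys f)) (sym (+-assoc (f x) _ _))

  ∑-cong : ∀ xs {f g : A → ℕ} → (∀ x → f x ≡ g x) → ∑ xs f ≡ ∑ xs g
  ∑-cong []       f≗g = refl
  ∑-cong (x ∷ xs) f≗g = cong₂ _+_ (f≗g x) (∑-cong xs f≗g)

  ∑-mono-≤ : ∀ xs {f g : A → ℕ} → (∀ x → f x ≤ g x) → ∑ xs f ≤ ∑ xs g
  ∑-mono-≤ []       f≤g = z≤n
  ∑-mono-≤ (x ∷ xs) f≤g = +-mono-≤ (f≤g x) (∑-mono-≤ xs f≤g)

  ∑-distrib-+ : ∀ xs (f g : A → ℕ) → ∑[ x ∈ xs ] (f x + g x) ≡ ∑ xs f + ∑ xs g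
  ∑-distrib-+ []       f g = refl
  ∑-distrib-+ (x ∷ xs) f g =
    trans (cong (f x + g x +_) (∑-distrib-+ xs f g)) (+-+-exchange (f x) (g x) _ _)
    where
    +-+-exchange : ∀ a b c d → a + b + (c + d) ≡ a + c + (b + d)
    +-+-exchange = solve 4 (λ a b c d → a :+ b :+ (c :+ d) := a :+ c :+ (b :+ d)) refl

  ∑-distrib-+₄ : ∀ xs (f g h k : A → ℕ) →
    ∑[ x ∈ xs ] (f x + g x + h x + k x) ≡ ∑ xs f + ∑ xs g + ∑ xs h + ∑ xs k
  ∑-distrib-+₄ xs f g h k =
    trans (∑-distrib-+ xs _ k) (cong (_+ ∑ xs k) (trans (∑-distrib-+ xs _ h) (cong (_+ ∑ xs h) (∑-distrib-+ xs f g))))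

  ∑-*ˡ : ∀ xs c (f : A → ℕ) → ∑[ x ∈ xs ] (c * f x) ≡ c * ∑ xs f
  ∑-*ˡ []       c f = sym (*-zeroʳ c)
  ∑-*ˡ (x ∷ xs) c f = trans (cong (c * f x +_) (∑-*ˡ xs c f)) (sym (*-distribˡ-+ c (f x) _))

  ∑-*ʳ : ∀ xs (f : A → ℕ) c → ∑[ x ∈ xs ] (f x * c) ≡ ∑ xs f * c
  ∑-*ʳ xs f c = begin
    ∑[ x ∈ xs ] (f x * c)  ≡⟨ ∑-cong xs (λ x → *-comm (f x) c) ⟩
    ∑[ x ∈ xs ] (c * f x)  ≡⟨ ∑-*ˡ xs c f ⟩
    c * ∑ xs f             ≡⟨ *-comm c _ ⟩
    ∑ xs f * c             ∎
    where open ≡-Reasoning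

  ∑-const : ∀ (xs : List A) c → ∑[ _ ∈ xs ] c ≡ length xs * c
  ∑-const []       c = refl
  ∑-const (x ∷ xs) c = cong (c +_) (∑-const xs c)

  ∈⇒≤∑ : ∀ {xs x} (f : A → ℕ) → x ∈ xs → f x ≤ ∑ xs f
  ∈⇒≤∑ f (here refl)            = m≤m+n _ _
  ∈⇒≤∑ {y ∷ _} f (there x∈xs) = ≤-trans (∈⇒≤∑ f x∈xs) (m≤n+m _ (f y))

  ∑-positive : ∀ xs (f : A → ℕ) → 0 < ∑ xs f → ∃[ x ] 0 < f x
  ∑-positive (x ∷ xs) f pos with f x in fx≡
  ... | suc _ = x , subst (0 <_) (sym fx≡) (s≤s z≤n)
  ... | zero  = ∑-positive xs f pos

  length-filterᵇ : ∀ (p : A → Bool) xs → length (filterᵇ p xs) ≡ ∑[ x ∈ xs ] 𝟙 (p x)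
  length-filterᵇ p []       = refl
  length-filterᵇ p (x ∷ xs) with p x
  ... | true  = cong suc (length-filterᵇ p xs)
  ... | false = length-filterᵇ p xs

  ∑-square : ∀ (xs : List A) f → ∑ xs f * ∑ xs f ≡ ∑[ x ∈ xs ] ∑[ y ∈ xs ] f x * f y
  ∑-square xs f = trans (sym (∑-*ʳ xs f (∑ xs f))) (∑-cong xs (λ x → sym (∑-*ˡ xs (f x) f)))

  ∑∑-*ˡ : ∀ (xs : List A) c (f : A → A → ℕ) → ∑[ x ∈ xs ] ∑[ y ∈ xs ] c * f x y ≡ c * (∑[ x ∈ xs ] ∑[ y ∈ xs ] f x y)
  ∑∑-*ˡ xs c f = trans (∑-cong xs (λ x → ∑-*ˡ xs c (f x))) (∑-*ˡ xs c _)

module _ {A B : Set} where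

  ∑-map : ∀ xs (h : A → B) (f : B → ℕ) → ∑ (List.map h xs) f ≡ ∑ xs (f ∘ h)
  ∑-map []       h f = refl
  ∑-map (x ∷ xs) h f = cong (f (h x) +_) (∑-map xs h f)

  ∑-concatMap : ∀ xs (g : A → List B) (f : B → ℕ) →
                ∑ (concatMap g xs) f ≡ ∑[ x ∈ xs ] ∑ (g x) f
  ∑-concatMap []       g f = refl
  ∑-concatMap (x ∷ xs) g f =
    trans (∑-++ (g x) (concatMap g xs) f) (cong (∑ (g x) f +_) (∑-concatMap xs g f))

  ∑-comm : ∀ xs ys (f : A → B → ℕ) → ∑[ x ∈ xs ] ∑[ y ∈ ys ] f x y ≡ ∑[ y ∈ ys ] ∑[ x ∈ xs ] f x y
  ∑-comm []       ys f = sym (trans (∑-const ys 0) (*-zeroʳ (length ys)))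
  ∑-comm (x ∷ xs) ys f = begin
    ∑ ys (f x) + (∑[ x′ ∈ xs ] ∑[ y ∈ ys ] f x′ y)  ≡⟨ cong (∑ ys (f x) +_) (∑-comm xs ys f) ⟩
    ∑ ys (f x) + (∑[ y ∈ ys ] ∑[ x′ ∈ xs ] f x′ y)  ≡⟨ ∑-distrib-+ ys (f x) _ ⟨
    ∑[ y ∈ ys ] (f x y + (∑[ x′ ∈ xs ] f x′ y))     ∎
    where open ≡-Reasoning

cross-term≤ : ∀ y A B C → A * A ≤ B * C → 2 * y * A ≤ C + B * (y * y)
cross-term≤ y zero    B       C A²≤BC = subst (_≤ C + B * (y * y)) (sym (*-zeroʳ (2 * y))) z≤n
cross-term≤ y (suc a) zero    C ()
cross-term≤ y A       B@(suc _) C A²≤BC = *-cancelˡ-≤ B (begin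
  B * (2 * y * A)              ≡⟨ rearrange₁ B y A ⟩
  2 * A * (B * y)              ≤⟨ 2*m*n≤m*m+n*n A (B * y) ⟩
  A * A + B * y * (B * y)      ≤⟨ +-monoˡ-≤ (B * y * (B * y)) A²≤BC ⟩
  B * C + B * y * (B * y)      ≡⟨ rearrange₂ B y C ⟩
  B * (C + B * (y * y))        ∎)
  where
  open ≤-Reasoning
  rearrange₁ : ∀ B y A → B * (2 * y * A) ≡ 2 * A * (B * y)
  rearrange₁ = solve 3 (λ B y A → B :* (con 2 :* y :* A) := con 2 :* A :* (B :* y)) refl
  rearrange₂ : ∀ B y C → B * C + B * y * (B * y) ≡ B * (C + B * (y * y))
  rearrange₂ = solve 3 (λ B y C → B :* C :+ B :* y :* (B :* y) := B :* (C :+ B :* (y :* y))) refl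

cauchy-schwarz-step : ∀ y A B C → A * A ≤ B * C → (y + A) * (y + A) ≤ (1 + B) * (y * y + C)
cauchy-schwarz-step y A B C A²≤BC = begin
  (y + A) * (y + A)                 ≡⟨ expand₁ y A ⟩
  y * y + 2 * y * A + A * A         ≤⟨ +-mono-≤ (+-monoʳ-≤ (y * y) (cross-term≤ y A B C A²≤BC)) A²≤BC ⟩
  y * y + (C + B * (y * y)) + B * C ≡⟨ expand₂ y C B ⟩
  (1 + B) * (y * y + C)             ∎
  where
  open ≤-Reasoning
  expand₁ : ∀ y A → (y + A) * (y + A) ≡ y * y + 2 * y * A + A * A
  expand₁ = solve 2 (λ y A → (y :+ A) :* (y :+ A) := y :* y :+ con 2 :* y :* A :+ A :* A) refl
  expand₂ : ∀ y C B → y * y + (C + B * (y * y)) + B * C ≡ (1 + B) * (y * y + C)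
  expand₂ = solve 3 (λ y C B → y :* y :+ (C :+ B :* (y :* y)) :+ B :* C := (con 1 :+ B) :* (y :* y :+ C)) refl

cauchy-schwarz-support : ∀ {A : Set} (as : List A) (f : A → ℕ) →
  ∑ as f * ∑ as f ≤ (∑[ a ∈ as ] 𝟙 (0 <ᵇ f a)) * (∑[ a ∈ as ] f a * f a)
cauchy-schwarz-support []       f = z≤n
cauchy-schwarz-support (a ∷ as) f with f a
... | zero  = cauchy-schwarz-support as f
... | suc y = cauchy-schwarz-step (suc y) _ (∑[ a ∈ as ] 𝟙 (0 <ᵇ f a)) _ (cauchy-schwarz-support as f)

δ : ∀ {M} → Fin M → Fin M → ℕ
δ x y = 𝟙 (does (x Fin.≟ y))

δ-refl : ∀ {M} (x : Fin M) → δ x x ≡ 1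
δ-refl x = cong 𝟙 (dec-true (x Fin.≟ x) refl)

length-allFin : ∀ M → length (allFin M) ≡ M
length-allFin M = length-tabulate {n = M} (λ i → i)

∑-allFin-suc : ∀ M (h : Fin (suc M) → ℕ) → ∑ (allFin (suc M)) h ≡ h Fin.zero + ∑ (allFin M) (h ∘ Fin.suc)
∑-allFin-suc M h = cong (λ hs → h Fin.zero + sum hs)
  (trans (map-tabulate Fin.suc h) (sym (map-tabulate (λ i → i) (h ∘ Fin.suc))))

∑-δ : ∀ M x (g : Fin M → ℕ) → ∑[ z ∈ allFin M ] (δ z x * g z) ≡ g x
∑-δ (suc M) Fin.zero    g = begin
  ∑[ z ∈ allFin (suc M) ] (δ z Fin.zero * g z) ≡⟨ ∑-allFin-suc M (λ z → δ z Fin.zero * g z) ⟩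
  1 * g Fin.zero + (∑[ z ∈ allFin M ] 0) ≡⟨ cong (1 * g Fin.zero +_) (trans (∑-const (allFin M) 0) (*-zeroʳ (length (allFin M)))) ⟩
  1 * g Fin.zero + 0                     ≡⟨ trans (+-identityʳ _) (*-identityˡ _) ⟩
  g Fin.zero                             ∎
  where open ≡-Reasoning
∑-δ (suc M) (Fin.suc x) g = trans (∑-allFin-suc M (λ z → δ z (Fin.suc x) * g z)) (∑-δ M x (g ∘ Fin.suc))

∑-lookup : ∀ {A : Set} (xs : List A) (f : A → ℕ) → ∑[ i ∈ allFin (length xs) ] f (List.lookup xs i) ≡ ∑ xs f
∑-lookup []       f = refl
∑-lookup (x ∷ xs) f = trans (∑-allFin-suc (length xs) (f ∘ List.lookup (x ∷ xs))) (cong (f x +_) (∑-lookup xs f))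

-- Sums over all sequences

take-++ : ∀ {A : Set} {m T} (g : Vec A m) (h : Vec A T) → Vec.take m (g Vec.++ h) ≡ g
take-++ {m = m} g h = ++-injectiveˡ (Vec.take m (g Vec.++ h)) g (take++drop≡id m (g Vec.++ h))

drop-++ : ∀ {A : Set} {m T} (g : Vec A m) (h : Vec A T) → Vec.drop m (g Vec.++ h) ≡ h
drop-++ {m = m} g h = ++-injectiveʳ (Vec.take m (g Vec.++ h)) g (take++drop≡id m (g Vec.++ h))

∑ᵛ : ∀ {A : Set} {T} → Vec A T → (A → ℕ) → ℕ
∑ᵛ a f = ∑ (Vec.toList a) f

module _ {A : Set} (xs : List A) where

  ∑-allVecs-suc : ∀ T (F : Vec A (suc T) → ℕ) →
                  ∑ (allVecs xs (suc T)) F ≡ ∑[ x ∈ xs ] ∑[ a ∈ allVecs xs T ] F (x ∷ a)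
  ∑-allVecs-suc T F =
    trans (∑-concatMap xs _ F) (∑-cong xs (λ x → ∑-map (allVecs xs T) (x ∷_) F))

  ∑-allVecs-const : ∀ T c → ∑[ _ ∈ allVecs xs T ] c ≡ length xs ^ T * c
  ∑-allVecs-const zero    c = refl
  ∑-allVecs-const (suc T) c = begin
    ∑[ _ ∈ allVecs xs (suc T) ] c          ≡⟨ ∑-allVecs-suc T (λ _ → c) ⟩
    ∑[ _ ∈ xs ] ∑[ _ ∈ allVecs xs T ] c    ≡⟨ ∑-cong xs (λ _ → ∑-allVecs-const T c) ⟩
    ∑[ _ ∈ xs ] (length xs ^ T * c)        ≡⟨ ∑-const xs _ ⟩
    length xs * (length xs ^ T * c)        ≡⟨ *-assoc (length xs) _ c ⟨
    length xs ^ suc T * c                  ∎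
    where open ≡-Reasoning

  ∑-allVecs-++ : ∀ m T (F : Vec A (m + T) → ℕ) →
                 ∑ (allVecs xs (m + T)) F ≡ ∑[ g ∈ allVecs xs m ] ∑[ h ∈ allVecs xs T ] F (g Vec.++ h)
  ∑-allVecs-++ zero    T F = sym (+-identityʳ _)
  ∑-allVecs-++ (suc m) T F = begin
    ∑ (allVecs xs (suc m + T)) F
      ≡⟨ ∑-allVecs-suc (m + T) F ⟩
    ∑[ x ∈ xs ] ∑[ a ∈ allVecs xs (m + T) ] F (x ∷ a)
      ≡⟨ ∑-cong xs (λ x → ∑-allVecs-++ m T (F ∘ (x ∷_))) ⟩
    ∑[ x ∈ xs ] ∑[ g ∈ allVecs xs m ] ∑[ h ∈ allVecs xs T ] F (x ∷ g Vec.++ h)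
      ≡⟨ ∑-allVecs-suc m (λ g → ∑[ h ∈ allVecs xs T ] F (g Vec.++ h)) ⟨
    ∑[ g ∈ allVecs xs (suc m) ] ∑[ h ∈ allVecs xs T ] F (g Vec.++ h)
      ∎
    where open ≡-Reasoning

  ∑-allVecs-split-* : ∀ m T (f : Vec A m → ℕ) (h : Vec A T → ℕ) →
    ∑[ a ∈ allVecs xs (m + T) ] (f (Vec.take m a) * h (Vec.drop m a)) ≡ ∑ (allVecs xs m) f * ∑ (allVecs xs T) h
  ∑-allVecs-split-* m T f h = begin
    ∑[ a ∈ allVecs xs (m + T) ] (f (Vec.take m a) * h (Vec.drop m a))
      ≡⟨ ∑-allVecs-++ m T _ ⟩
    ∑[ g ∈ allVecs xs m ] ∑[ b ∈ allVecs xs T ] (f (Vec.take m (g Vec.++ b)) * h (Vec.drop m (g Vec.++ b)))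
      ≡⟨ ∑-cong (allVecs xs m) (λ g → ∑-cong (allVecs xs T) (λ b →
           cong₂ (λ u v → f u * h v) (take-++ g b) (drop-++ g b))) ⟩
    ∑[ g ∈ allVecs xs m ] ∑[ b ∈ allVecs xs T ] (f g * h b)
      ≡⟨ ∑-cong (allVecs xs m) (λ g → ∑-*ˡ (allVecs xs T) (f g) h) ⟩
    ∑[ g ∈ allVecs xs m ] (f g * ∑ (allVecs xs T) h)
      ≡⟨ ∑-*ʳ (allVecs xs m) f _ ⟩
    ∑ (allVecs xs m) f * ∑ (allVecs xs T) h
      ∎
    where open ≡-Reasoning

  ∑-allVecs-additive : ∀ T (f : A → ℕ) →
    length xs * (∑[ a ∈ allVecs xs T ] ∑ᵛ a f) ≡ T * length xs ^ T * ∑ xs f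
  ∑-allVecs-additive zero    f = *-zeroʳ (length xs)
  ∑-allVecs-additive (suc T) f = begin
    M * (∑[ a ∈ allVecs xs (suc T) ] ∑ᵛ a f)
      ≡⟨ cong (M *_) (∑-allVecs-suc T (λ a → ∑ᵛ a f)) ⟩
    M * (∑[ x ∈ xs ] ∑[ a ∈ allVecs xs T ] (f x + ∑ᵛ a f))
      ≡⟨ cong (M *_) (∑-cong xs (λ x → ∑-distrib-+ (allVecs xs T) (λ _ → f x) (λ a → ∑ᵛ a f))) ⟩
    M * (∑[ x ∈ xs ] ((∑[ _ ∈ allVecs xs T ] f x) + E))
      ≡⟨ cong (M *_) (∑-distrib-+ xs _ (λ _ → E)) ⟩
    M * ((∑[ x ∈ xs ] ∑[ _ ∈ allVecs xs T ] f x) + (∑[ _ ∈ xs ] E))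
      ≡⟨ cong₂ (λ u v → M * (u + v))
           (trans (∑-cong xs (λ x → ∑-allVecs-const T (f x))) (∑-*ˡ xs (M ^ T) f)) (∑-const xs E) ⟩
    M * (M ^ T * ∑ xs f + M * E)
      ≡⟨ cong (λ u → M * (M ^ T * ∑ xs f + u)) (∑-allVecs-additive T f) ⟩
    M * (M ^ T * ∑ xs f + T * M ^ T * ∑ xs f)
      ≡⟨ collect M (M ^ T) (∑ xs f) T ⟩
    suc T * (M * M ^ T) * ∑ xs f
      ∎
    where
    open ≡-Reasoning
    M = length xs
    E = ∑[ a ∈ allVecs xs T ] ∑ᵛ a f
    collect : ∀ M P F T → M * (P * F + T * P * F) ≡ suc T * (M * P) * F
    collect = solve 4 (λ M P F T → M :* (P :* F :+ T :* P :* F) := (con 1 :+ T) :* (M :* P) :* F) refl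

  ∑-allVecs-suc-product : ∀ T (f g : A → ℕ) →
    ∑[ a ∈ allVecs xs (suc T) ] ∑ᵛ a f * ∑ᵛ a g
      ≡ length xs ^ T * (∑[ x ∈ xs ] f x * g x) + ∑ xs f * (∑[ a ∈ allVecs xs T ] ∑ᵛ a g)
        + ∑ xs g * (∑[ a ∈ allVecs xs T ] ∑ᵛ a f) + length xs * (∑[ a ∈ allVecs xs T ] ∑ᵛ a f * ∑ᵛ a g)
  ∑-allVecs-suc-product T f g = begin
    ∑[ a ∈ allVecs xs (suc T) ] ∑ᵛ a f * ∑ᵛ a g
      ≡⟨ ∑-allVecs-suc T (λ a → ∑ᵛ a f * ∑ᵛ a g) ⟩
    ∑[ x ∈ xs ] ∑[ a ∈ vs ] (f x + ∑ᵛ a f) * (g x + ∑ᵛ a g)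
      ≡⟨ ∑-cong xs (λ x → ∑-cong vs (λ a → expand (f x) (g x) (∑ᵛ a f) (∑ᵛ a g))) ⟩
    ∑[ x ∈ xs ] ∑[ a ∈ vs ] (f x * g x + f x * ∑ᵛ a g + g x * ∑ᵛ a f + ∑ᵛ a f * ∑ᵛ a g)
      ≡⟨ ∑-cong xs (λ x → ∑-distrib-+₄ vs _ _ _ _) ⟩
    ∑[ x ∈ xs ] ((∑[ _ ∈ vs ] f x * g x) + (∑[ a ∈ vs ] f x * ∑ᵛ a g) + (∑[ a ∈ vs ] g x * ∑ᵛ a f) + Q)
      ≡⟨ ∑-cong xs (λ x → cong₂ (λ u v → u + v + Q)
           (cong₂ _+_ (∑-allVecs-const T _) (∑-*ˡ vs (f x) (λ a → ∑ᵛ a g))) (∑-*ˡ vs (g x) (λ a → ∑ᵛ a f))) ⟩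
    ∑[ x ∈ xs ] (M ^ T * (f x * g x) + f x * Eg + g x * Ef + Q)
      ≡⟨ ∑-distrib-+₄ xs _ _ _ _ ⟩
    (∑[ x ∈ xs ] M ^ T * (f x * g x)) + (∑[ x ∈ xs ] f x * Eg) + (∑[ x ∈ xs ] g x * Ef) + (∑[ _ ∈ xs ] Q)
      ≡⟨ cong₂ _+_ (cong₂ _+_ (cong₂ _+_ (∑-*ˡ xs (M ^ T) _) (∑-*ʳ xs f Eg)) (∑-*ʳ xs g Ef)) (∑-const xs Q) ⟩
    M ^ T * (∑[ x ∈ xs ] f x * g x) + ∑ xs f * Eg + ∑ xs g * Ef + M * Q
      ∎
    where
    open ≡-Reasoning
    M = length xs
    vs = allVecs xs T
    Ef = ∑[ a ∈ vs ] ∑ᵛ a f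
    Eg = ∑[ a ∈ vs ] ∑ᵛ a g
    Q = ∑[ a ∈ vs ] ∑ᵛ a f * ∑ᵛ a g
    expand : ∀ p q u v → (p + u) * (q + v) ≡ p * q + p * v + q * u + u * v
    expand = solve 4 (λ p q u v → (p :+ u) :* (q :+ v) := p :* q :+ p :* v :+ q :* u :+ u :* v) refl

  ∑-allVecs-additive² : ∀ T (f g : A → ℕ) →
    length xs * length xs * (∑[ a ∈ allVecs xs T ] ∑ᵛ a f * ∑ᵛ a g)
      ≤ T * T * length xs ^ T * (∑ xs f * ∑ xs g) + T * length xs ^ suc T * (∑[ x ∈ xs ] f x * g x)
  ∑-allVecs-additive² zero    f g = ≤-reflexive (*-zeroʳ (length xs * length xs))
  ∑-allVecs-additive² (suc T) f g = begin
    M * M * (∑[ a ∈ allVecs xs (suc T) ] ∑ᵛ a f * ∑ᵛ a g)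
      ≡⟨ cong (M * M *_) (∑-allVecs-suc-product T f g) ⟩
    M * M * (M ^ T * H + F * Eg + G * Ef + M * Q)
      ≡⟨ regroup M (M ^ T) H F G Eg Ef Q ⟩
    M * M * M ^ T * H + M * F * (M * Eg) + M * G * (M * Ef) + M * (M * M * Q)
      ≤⟨ +-monoʳ-≤ (M * M * M ^ T * H + M * F * (M * Eg) + M * G * (M * Ef))
           (*-monoʳ-≤ M (∑-allVecs-additive² T f g)) ⟩
    M * M * M ^ T * H + M * F * (M * Eg) + M * G * (M * Ef) + M * (T * T * M ^ T * (F * G) + T * (M * M ^ T) * H)
      ≡⟨ cong₂ (λ u v → M * M * M ^ T * H + M * F * u + M * G * v + M * (T * T * M ^ T * (F * G) + T * (M * M ^ T) * H))
           (∑-allVecs-additive T g) (∑-allVecs-additive T f) ⟩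
    M * M * M ^ T * H + M * F * (T * M ^ T * G) + M * G * (T * M ^ T * F) + M * (T * T * M ^ T * (F * G) + T * (M * M ^ T) * H)
      ≤⟨ m≤m+n _ (M * M ^ T * (F * G)) ⟩
    M * M * M ^ T * H + M * F * (T * M ^ T * G) + M * G * (T * M ^ T * F) + M * (T * T * M ^ T * (F * G) + T * (M * M ^ T) * H)
      + M * M ^ T * (F * G)
      ≡⟨ collect M (M ^ T) F G H T ⟩
    suc T * suc T * (M * M ^ T) * (F * G) + suc T * (M * (M * M ^ T)) * H
      ∎
    where
    open ≤-Reasoning
    M = length xs
    F = ∑ xs f
    G = ∑ xs g
    H = ∑[ x ∈ xs ] f x * g x
    Ef = ∑[ a ∈ allVecs xs T ] ∑ᵛ a f
    Eg = ∑[ a ∈ allVecs xs T ] ∑ᵛ a g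
    Q = ∑[ a ∈ allVecs xs T ] ∑ᵛ a f * ∑ᵛ a g
    regroup : ∀ M P H F G Eg Ef Q →
      M * M * (P * H + F * Eg + G * Ef + M * Q) ≡ M * M * P * H + M * F * (M * Eg) + M * G * (M * Ef) + M * (M * M * Q)
    regroup = solve 8 (λ M P H F G Eg Ef Q →
      M :* M :* (P :* H :+ F :* Eg :+ G :* Ef :+ M :* Q) := M :* M :* P :* H :+ M :* F :* (M :* Eg) :+ M :* G :* (M :* Ef) :+ M :* (M :* M :* Q)) refl
    collect : ∀ M P F G H T →
      M * M * P * H + M * F * (T * P * G) + M * G * (T * P * F) + M * (T * T * P * (F * G) + T * (M * P) * H) + M * P * (F * G)
        ≡ suc T * suc T * (M * P) * (F * G) + suc T * (M * (M * P)) * H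
    collect = solve 6 (λ M P F G H T →
      M :* M :* P :* H :+ M :* F :* (T :* P :* G) :+ M :* G :* (T :* P :* F) :+ M :* (T :* T :* P :* (F :* G) :+ T :* (M :* P) :* H) :+ M :* P :* (F :* G)
        := (con 1 :+ T) :* (con 1 :+ T) :* (M :* P) :* (F :* G) :+ (con 1 :+ T) :* (M :* (M :* P)) :* H) refl
-- Block products and the second moment

toList-take-drop : ∀ {A : Set} m {T} (a : Vec A (m + T)) →
                   Vec.toList a ≡ Vec.toList (Vec.take m a) ++ Vec.toList (Vec.drop m a)
toList-take-drop m a = trans (cong Vec.toList (sym (take++drop≡id m a))) (toList-++ (Vec.take m a) (Vec.drop m a))

module Blocks {A : Set} (m r : ℕ) where

  blocksLength : ℕ → ℕ
  blocksLength zero    = r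
  blocksLength (suc k) = m + blocksLength k

  blocksLength≡ : ∀ k → blocksLength k ≡ k * m + r
  blocksLength≡ zero    = refl
  blocksLength≡ (suc k) = trans (cong (m +_) (blocksLength≡ k)) (sym (+-assoc m (k * m) r))

  ^-blocksLength : ∀ n k → n ^ blocksLength k ≡ (n ^ m) ^ k * n ^ r
  ^-blocksLength n zero    = sym (+-identityʳ (n ^ r))
  ^-blocksLength n (suc k) = begin
    n ^ (m + blocksLength k)         ≡⟨ ^-distribˡ-+-* n m (blocksLength k) ⟩
    n ^ m * n ^ blocksLength k       ≡⟨ cong (n ^ m *_) (^-blocksLength n k) ⟩
    n ^ m * ((n ^ m) ^ k * n ^ r)    ≡⟨ *-assoc (n ^ m) _ _ ⟨
    (n ^ m) ^ suc k * n ^ r          ∎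
    where open ≡-Reasoning

  blockProduct : (Vec A m → ℕ) → ∀ k → Vec A (blocksLength k) → ℕ
  blockProduct f zero    a = 1
  blockProduct f (suc k) a = f (Vec.take m a) * blockProduct f k (Vec.drop m a)

  blockProduct-* : ∀ (f g : Vec A m → ℕ) k a →
                   blockProduct f k a * blockProduct g k a ≡ blockProduct (λ b → f b * g b) k a
  blockProduct-* f g zero    a = refl
  blockProduct-* f g (suc k) a =
    trans ([m*n]*[o*p]≡[m*o]*[n*p] (f (Vec.take m a)) _ (g (Vec.take m a)) _)
          (cong (f (Vec.take m a) * g (Vec.take m a) *_) (blockProduct-* f g k (Vec.drop m a)))

  ∑-blockProduct : ∀ (xs : List A) f k →
    ∑ (allVecs xs (blocksLength k)) (blockProduct f k) ≡ ∑ (allVecs xs m) f ^ k * length xs ^ r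
  ∑-blockProduct xs f zero    = trans (∑-allVecs-const xs r 1) (trans (*-identityʳ _) (sym (+-identityʳ _)))
  ∑-blockProduct xs f (suc k) = begin
    ∑ (allVecs xs (m + blocksLength k)) (blockProduct f (suc k))
      ≡⟨ ∑-allVecs-split-* xs m (blocksLength k) f (blockProduct f k) ⟩
    ∑ (allVecs xs m) f * ∑ (allVecs xs (blocksLength k)) (blockProduct f k)
      ≡⟨ cong (∑ (allVecs xs m) f *_) (∑-blockProduct xs f k) ⟩
    ∑ (allVecs xs m) f * (∑ (allVecs xs m) f ^ k * length xs ^ r)
      ≡⟨ *-assoc (∑ (allVecs xs m) f) _ _ ⟨
    ∑ (allVecs xs m) f ^ suc k * length xs ^ r
      ∎
    where open ≡-Reasoning

  0<blockProduct⇒k≤∑ᵛ : ∀ (h : A → ℕ) k (a : Vec A (blocksLength k)) →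
    0 < blockProduct (λ b → ∑ᵛ b h) k a → k ≤ ∑ᵛ a h
  0<blockProduct⇒k≤∑ᵛ h zero    a _   = z≤n
  0<blockProduct⇒k≤∑ᵛ h (suc k) a pos = begin
    1 + k                                                           ≤⟨ +-mono-≤ (0<m*n⇒0<m _ pos) rest ⟩
    ∑ᵛ (Vec.take m a) h + ∑ᵛ (Vec.drop m a) h                       ≡⟨ ∑-++ (Vec.toList (Vec.take m a)) _ h ⟨
    ∑ (Vec.toList (Vec.take m a) ++ Vec.toList (Vec.drop m a)) h    ≡⟨ cong (λ l → ∑ l h) (toList-take-drop m a) ⟨
    ∑ᵛ a h                                                          ∎
    where
    open ≤-Reasoning
    rest = 0<blockProduct⇒k≤∑ᵛ h k (Vec.drop m a) (0<m*n⇒0<n (∑ᵛ (Vec.take m a) h) pos)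

occurrences : ∀ {M T} → Fin M → Vec (Fin M) T → ℕ
occurrences x a = ∑ᵛ a (λ i → δ i x)

∑-δ-const : ∀ M x → ∑[ z ∈ allFin M ] δ z x ≡ 1
∑-δ-const M x = trans (∑-cong (allFin M) (λ z → sym (*-identityʳ (δ z x)))) (∑-δ M x (λ _ → 1))

M*∑occurrences≡T*M^T : ∀ M T x → M * ∑ (allVecs (allFin M) T) (occurrences x) ≡ T * M ^ T
M*∑occurrences≡T*M^T M T x = begin
  M * ∑ (allVecs (allFin M) T) (occurrences x)
    ≡⟨ cong (_* ∑ (allVecs (allFin M) T) (occurrences x)) (length-allFin M) ⟨
  length (allFin M) * ∑ (allVecs (allFin M) T) (occurrences x)
    ≡⟨ ∑-allVecs-additive (allFin M) T (λ i → δ i x) ⟩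
  T * length (allFin M) ^ T * (∑[ i ∈ allFin M ] δ i x)
    ≡⟨ cong₂ (λ l s → T * l ^ T * s) (length-allFin M) (∑-δ-const M x) ⟩
  T * M ^ T * 1
    ≡⟨ *-identityʳ _ ⟩
  T * M ^ T
    ∎
  where open ≡-Reasoning

M*M*∑occurrences²≤ : ∀ M T x y →
  M * M * (∑[ a ∈ allVecs (allFin M) T ] occurrences x a * occurrences y a) ≤ T * T * M ^ T + T * M ^ suc T * δ x y
M*M*∑occurrences²≤ M T x y = begin
  M * M * Q
    ≡⟨ cong (λ l → l * l * Q) (length-allFin M) ⟨
  length (allFin M) * length (allFin M) * Q
    ≤⟨ ∑-allVecs-additive² (allFin M) T (λ i → δ i x) (λ i → δ i y) ⟩
  T * T * length (allFin M) ^ T * ((∑[ i ∈ allFin M ] δ i x) * (∑[ i ∈ allFin M ] δ i y))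
    + T * length (allFin M) ^ suc T * (∑[ i ∈ allFin M ] δ i x * δ i y)
    ≡⟨ cong₂ (λ l s → T * T * l ^ T * s + T * l ^ suc T * (∑[ i ∈ allFin M ] δ i x * δ i y))
         (length-allFin M) (cong₂ _*_ (∑-δ-const M x) (∑-δ-const M y)) ⟩
  T * T * M ^ T * 1 + T * M ^ suc T * (∑[ i ∈ allFin M ] δ i x * δ i y)
    ≡⟨ cong₂ _+_ (*-identityʳ _) (cong (T * M ^ suc T *_) (∑-δ M x (λ i → δ i y))) ⟩
  T * T * M ^ T + T * M ^ suc T * δ x y
    ∎
  where
  open ≤-Reasoning
  Q = ∑[ a ∈ allVecs (allFin M) T ] occurrences x a * occurrences y a

[m+𝟙b*M]^k≤m^k+𝟙b*[M+m]^k : ∀ b m M k → (m + 𝟙 b * M) ^ k ≤ m ^ k + 𝟙 b * (M + m) ^ k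
[m+𝟙b*M]^k≤m^k+𝟙b*[M+m]^k false m M k =
  ≤-reflexive (trans (cong (_^ k) (+-identityʳ m)) (sym (+-identityʳ (m ^ k))))
[m+𝟙b*M]^k≤m^k+𝟙b*[M+m]^k true  m M k = begin
  (m + (M + 0)) ^ k       ≡⟨ cong (λ u → u ^ k) (trans (cong (m +_) (+-identityʳ M)) (+-comm m M)) ⟩
  (M + m) ^ k             ≤⟨ m≤n+m _ (m ^ k) ⟩
  m ^ k + (M + m) ^ k     ≡⟨ cong (m ^ k +_) (+-identityʳ _) ⟨
  m ^ k + ((M + m) ^ k + 0) ∎
  where open ≤-Reasoning

module SecondMoment (M m r k : ℕ) .{{_ : NonZero M}} .{{_ : NonZero m}} where

  open Blocks {Fin M} m r

  L : ℕ
  L = blocksLength k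

  sequences : List (Vec (Fin M) L)
  sequences = allVecs (allFin M) L

  -- Z a > 0 exactly when some label occurs in every block of a.
  Z : Vec (Fin M) L → ℕ
  Z a = ∑[ x ∈ allFin M ] blockProduct (occurrences x) k a

  -- M times the number of occurrences of any fixed label, summed over all blocks.
  C : ℕ
  C = m * M ^ m

  ∑-blockProduct-allFin : ∀ f → ∑ sequences (blockProduct f k) ≡ ∑ (allVecs (allFin M) m) f ^ k * M ^ r
  ∑-blockProduct-allFin f =
    trans (∑-blockProduct (allFin M) f k) (cong (λ l → ∑ (allVecs (allFin M) m) f ^ k * l ^ r) (length-allFin M))

  first-moment : M ^ k * ∑ sequences Z ≡ M ^ r * (M * C ^ k)
  first-moment = begin
    M ^ k * ∑ sequences Z
      ≡⟨ cong (M ^ k *_) (∑-comm sequences (allFin M) (λ a x → blockProduct (occurrences x) k a)) ⟩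
    M ^ k * (∑[ x ∈ allFin M ] ∑ sequences (blockProduct (occurrences x) k))
      ≡⟨ cong (M ^ k *_) (∑-cong (allFin M) (λ x → ∑-blockProduct-allFin (occurrences x))) ⟩
    M ^ k * (∑[ x ∈ allFin M ] c₁ x ^ k * M ^ r)
      ≡⟨ ∑-*ˡ (allFin M) (M ^ k) _ ⟨
    ∑[ x ∈ allFin M ] M ^ k * (c₁ x ^ k * M ^ r)
      ≡⟨ ∑-cong (allFin M) per-label ⟩
    ∑[ _ ∈ allFin M ] M ^ r * C ^ k
      ≡⟨ trans (∑-const (allFin M) _) (cong (_* (M ^ r * C ^ k)) (length-allFin M)) ⟩
    M * (M ^ r * C ^ k)
      ≡⟨ x∙yz≈y∙xz M (M ^ r) (C ^ k) ⟩
    M ^ r * (M * C ^ k)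
      ∎
    where
    open ≡-Reasoning
    c₁ : Fin M → ℕ
    c₁ x = ∑ (allVecs (allFin M) m) (occurrences x)
    per-label : ∀ x → M ^ k * (c₁ x ^ k * M ^ r) ≡ M ^ r * C ^ k
    per-label x = begin
      M ^ k * (c₁ x ^ k * M ^ r)  ≡⟨ trans (sym (*-assoc (M ^ k) _ _)) (*-comm _ (M ^ r)) ⟩
      M ^ r * (M ^ k * c₁ x ^ k)  ≡⟨ cong (M ^ r *_) (^-distrib-* M (c₁ x) k) ⟨
      M ^ r * (M * c₁ x) ^ k      ≡⟨ cong (λ u → M ^ r * u ^ k) (M*∑occurrences≡T*M^T M m x) ⟩
      M ^ r * C ^ k               ∎

  c₂ : Fin M → Fin M → ℕ
  c₂ x y = ∑[ g ∈ allVecs (allFin M) m ] occurrences x g * occurrences y g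

  [M*M*c₂]^k≤ : ∀ x y → (M * M * c₂ x y) ^ k ≤ C ^ k * (m ^ k + δ x y * (M + m) ^ k)
  [M*M*c₂]^k≤ x y = begin
    (M * M * c₂ x y) ^ k                    ≤⟨ ^-monoˡ-≤ k (M*M*∑occurrences²≤ M m x y) ⟩
    (m * m * M ^ m + m * M ^ suc m * δ x y) ^ k ≡⟨ cong (_^ k) (factor m (M ^ m) M (δ x y)) ⟩
    (C * (m + δ x y * M)) ^ k               ≡⟨ ^-distrib-* C _ k ⟩
    C ^ k * (m + δ x y * M) ^ k             ≤⟨ *-monoʳ-≤ (C ^ k) ([m+𝟙b*M]^k≤m^k+𝟙b*[M+m]^k (does (x Fin.≟ y)) m M k) ⟩
    C ^ k * (m ^ k + δ x y * (M + m) ^ k)   ∎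
    where
    open ≤-Reasoning
    factor : ∀ m P M d → m * m * P + m * (M * P) * d ≡ m * P * (m + d * M)
    factor = solve 4 (λ m P M d → m :* m :* P :+ m :* (M :* P) :* d := m :* P :* (m :+ d :* M)) refl

  ∑∑[a+δ*R] : ∀ a R → ∑[ x ∈ allFin M ] ∑[ y ∈ allFin M ] (a + δ x y * R) ≡ M * (M * a + R)
  ∑∑[a+δ*R] a R = begin
    ∑[ x ∈ allFin M ] ∑[ y ∈ allFin M ] (a + δ x y * R)  ≡⟨ ∑-comm (allFin M) (allFin M) _ ⟩
    ∑[ y ∈ allFin M ] ∑[ x ∈ allFin M ] (a + δ x y * R)  ≡⟨ ∑-cong (allFin M) inner ⟩
    ∑[ _ ∈ allFin M ] (M * a + R)                        ≡⟨ trans (∑-const (allFin M) _) (cong (_* (M * a + R)) (length-allFin M)) ⟩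
    M * (M * a + R)                                      ∎
    where
    open ≡-Reasoning
    inner : ∀ y → ∑[ x ∈ allFin M ] (a + δ x y * R) ≡ M * a + R
    inner y = trans (∑-distrib-+ (allFin M) (λ _ → a) (λ x → δ x y * R))
                    (cong₂ _+_ (trans (∑-const (allFin M) a) (cong (_* a) (length-allFin M))) (∑-δ M y (λ _ → R)))

  second-moment : (M * M) ^ k * (∑[ a ∈ sequences ] Z a * Z a) ≤ M ^ r * (C ^ k * (M * (M * m ^ k + (M + m) ^ k)))
  second-moment = begin
    (M * M) ^ k * (∑[ a ∈ sequences ] Z a * Z a)
      ≡⟨ cong ((M * M) ^ k *_) (∑-cong sequences (λ a → ∑-square (allFin M) (λ x → blockProduct (occurrences x) k a))) ⟩
    (M * M) ^ k * (∑[ a ∈ sequences ] ∑[ x ∈ allFin M ] ∑[ y ∈ allFin M ] bp x a * bp y a)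
      ≡⟨ cong ((M * M) ^ k *_) (∑-comm sequences (allFin M) _) ⟩
    (M * M) ^ k * (∑[ x ∈ allFin M ] ∑[ a ∈ sequences ] ∑[ y ∈ allFin M ] bp x a * bp y a)
      ≡⟨ cong ((M * M) ^ k *_) (∑-cong (allFin M) (λ x → ∑-comm sequences (allFin M) _)) ⟩
    (M * M) ^ k * (∑[ x ∈ allFin M ] ∑[ y ∈ allFin M ] ∑[ a ∈ sequences ] bp x a * bp y a)
      ≡⟨ cong ((M * M) ^ k *_) (∑-cong (allFin M) (λ x → ∑-cong (allFin M) (λ y → moment x y))) ⟩
    (M * M) ^ k * (∑[ x ∈ allFin M ] ∑[ y ∈ allFin M ] M ^ r * c₂ x y ^ k)
      ≡⟨ ∑∑-*ˡ (allFin M) ((M * M) ^ k) _ ⟨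
    ∑[ x ∈ allFin M ] ∑[ y ∈ allFin M ] (M * M) ^ k * (M ^ r * c₂ x y ^ k)
      ≡⟨ ∑-cong (allFin M) (λ x → ∑-cong (allFin M) (λ y → regroup x y)) ⟩
    ∑[ x ∈ allFin M ] ∑[ y ∈ allFin M ] M ^ r * (M * M * c₂ x y) ^ k
      ≤⟨ ∑-mono-≤ (allFin M) (λ x → ∑-mono-≤ (allFin M) (λ y → *-monoʳ-≤ (M ^ r) ([M*M*c₂]^k≤ x y))) ⟩
    ∑[ x ∈ allFin M ] ∑[ y ∈ allFin M ] M ^ r * (C ^ k * (m ^ k + δ x y * (M + m) ^ k))
      ≡⟨ trans (∑∑-*ˡ (allFin M) (M ^ r) _) (cong (M ^ r *_) (∑∑-*ˡ (allFin M) (C ^ k) _)) ⟩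
    M ^ r * (C ^ k * (∑[ x ∈ allFin M ] ∑[ y ∈ allFin M ] (m ^ k + δ x y * (M + m) ^ k)))
      ≡⟨ cong (λ u → M ^ r * (C ^ k * u)) (∑∑[a+δ*R] (m ^ k) ((M + m) ^ k)) ⟩
    M ^ r * (C ^ k * (M * (M * m ^ k + (M + m) ^ k)))
      ∎
    where
    open ≤-Reasoning
    bp : Fin M → Vec (Fin M) L → ℕ
    bp x = blockProduct (occurrences x) k
    moment : ∀ x y → ∑[ a ∈ sequences ] bp x a * bp y a ≡ M ^ r * c₂ x y ^ k
    moment x y = begin-equality
      ∑[ a ∈ sequences ] bp x a * bp y a
        ≡⟨ ∑-cong sequences (blockProduct-* (occurrences x) (occurrences y) k) ⟩
      ∑ sequences (blockProduct (λ g → occurrences x g * occurrences y g) k)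
        ≡⟨ ∑-blockProduct-allFin _ ⟩
      c₂ x y ^ k * M ^ r
        ≡⟨ *-comm _ (M ^ r) ⟩
      M ^ r * c₂ x y ^ k
        ∎
    regroup : ∀ x y → (M * M) ^ k * (M ^ r * c₂ x y ^ k) ≡ M ^ r * (M * M * c₂ x y) ^ k
    regroup x y = begin-equality
      (M * M) ^ k * (M ^ r * c₂ x y ^ k)  ≡⟨ x∙yz≈y∙xz ((M * M) ^ k) (M ^ r) _ ⟩
      M ^ r * ((M * M) ^ k * c₂ x y ^ k)  ≡⟨ cong (M ^ r *_) (^-distrib-* (M * M) (c₂ x y) k) ⟨
      M ^ r * (M * M * c₂ x y) ^ k        ∎

  M^L*∑Z²≤2*[∑Z]² : (M + m) ^ k ≤ M * m ^ k → M ^ L * (∑[ a ∈ sequences ] Z a * Z a) ≤ 2 * (∑ sequences Z * ∑ sequences Z)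
  -- Multiplied by (M·M)^k, both moments become monomials in M, M ^ r, m ^ k and (M ^ m) ^ k.
  M^L*∑Z²≤2*[∑Z]² H = *-cancelˡ-≤ ((M * M) ^ k) {{m^n≢0 (M * M) k {{m*n≢0 M M}}}} (begin
    (M * M) ^ k * (M ^ L * Σ₂)
      ≡⟨ x∙yz≈y∙xz ((M * M) ^ k) (M ^ L) Σ₂ ⟩
    M ^ L * ((M * M) ^ k * Σ₂)
      ≤⟨ *-monoʳ-≤ (M ^ L) second-moment ⟩
    M ^ L * (M ^ r * (C ^ k * (M * (M * m ^ k + (M + m) ^ k))))
      ≤⟨ *-monoʳ-≤ (M ^ L) (*-monoʳ-≤ (M ^ r) (*-monoʳ-≤ (C ^ k) (*-monoʳ-≤ M (+-monoʳ-≤ (M * m ^ k) H)))) ⟩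
    M ^ L * (M ^ r * (C ^ k * (M * (M * m ^ k + M * m ^ k))))
      ≡⟨ cong₂ (λ u v → u * (M ^ r * (v * (M * (M * m ^ k + M * m ^ k)))))
           (^-blocksLength M k) (^-distrib-* m (M ^ m) k) ⟩
    (M ^ m) ^ k * M ^ r * (M ^ r * (m ^ k * (M ^ m) ^ k * (M * (M * m ^ k + M * m ^ k))))
      ≡⟨ both-sides ((M ^ m) ^ k) (M ^ r) (m ^ k) M ⟩
    2 * (M ^ r * (M * (m ^ k * (M ^ m) ^ k))) * (M ^ r * (M * (m ^ k * (M ^ m) ^ k)))
      ≡⟨ cong (λ u → 2 * (M ^ r * (M * u)) * (M ^ r * (M * u))) (^-distrib-* m (M ^ m) k) ⟨
    2 * (M ^ r * (M * C ^ k)) * (M ^ r * (M * C ^ k))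
      ≡⟨ cong (λ u → 2 * u * u) first-moment ⟨
    2 * (M ^ k * Σ₁) * (M ^ k * Σ₁)
      ≡⟨ square-factor (M ^ k) Σ₁ ⟩
    M ^ k * M ^ k * (2 * (Σ₁ * Σ₁))
      ≡⟨ cong (_* (2 * (Σ₁ * Σ₁))) (^-distrib-* M M k) ⟨
    (M * M) ^ k * (2 * (Σ₁ * Σ₁))
      ∎)
    where
    open ≤-Reasoning
    Σ₁ = ∑ sequences Z
    Σ₂ = ∑[ a ∈ sequences ] Z a * Z a
    both-sides : ∀ A B μ M → A * B * (B * (μ * A * (M * (M * μ + M * μ)))) ≡ 2 * (B * (M * (μ * A))) * (B * (M * (μ * A)))
    both-sides = solve 4 (λ A B μ M → A :* B :* (B :* (μ :* A :* (M :* (M :* μ :+ M :* μ))))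
                                     := con 2 :* (B :* (M :* (μ :* A))) :* (B :* (M :* (μ :* A)))) refl
    square-factor : ∀ a s → 2 * (a * s) * (a * s) ≡ a * a * (2 * (s * s))
    square-factor = solve 2 (λ a s → con 2 :* (a :* s) :* (a :* s) := a :* a :* (con 2 :* (s :* s))) refl

  M^L≤2*#[Z>0] : (M + m) ^ k ≤ M * m ^ k → M ^ L ≤ 2 * (∑[ a ∈ sequences ] 𝟙 (0 <ᵇ Z a))
  M^L≤2*#[Z>0] H = *-cancelʳ-≤ (M ^ L) (2 * Pos) Σ₂ {{ℕ.>-nonZero 0<Σ₂}} (begin
    M ^ L * Σ₂              ≤⟨ M^L*∑Z²≤2*[∑Z]² H ⟩
    2 * (Σ₁ * Σ₁)           ≤⟨ *-monoʳ-≤ 2 (cauchy-schwarz-support sequences Z) ⟩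
    2 * (Pos * Σ₂)          ≡⟨ *-assoc 2 Pos Σ₂ ⟨
    2 * Pos * Σ₂            ∎)
    where
    open ≤-Reasoning
    Σ₁ = ∑ sequences Z
    Σ₂ = ∑[ a ∈ sequences ] Z a * Z a
    Pos = ∑[ a ∈ sequences ] 𝟙 (0 <ᵇ Z a)
    0<M^k*Σ₁ : 0 < M ^ k * Σ₁
    0<M^k*Σ₁ = subst (0 <_) (sym first-moment)
      (0<m*n (m^n>0 M r) (0<m*n (ℕ.>-nonZero⁻¹ M) (m^n>0 C {{ℕ.>-nonZero 0<C}} k)))
      where
      0<C : 0 < C
      0<C = 0<m*n (ℕ.>-nonZero⁻¹ m) (m^n>0 M m)
    0<Σ₂ : 0 < Σ₂
    0<Σ₂ = <-≤-trans (0<m*n⇒0<n (M ^ k) 0<M^k*Σ₁) (∑-mono-≤ sequences (λ a → m≤m*m (Z a)))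

-- Loads of orientations

≤-foldr-⊔ : ∀ {A : Set} {xs : List A} {x} (f : A → ℕ) → x ∈ xs → f x ≤ foldr ℕ._⊔_ 0 (List.map f xs)
≤-foldr-⊔ f (here refl)             = m≤m⊔n _ _
≤-foldr-⊔ {xs = y ∷ _} f (there x∈xs) = ≤-trans (≤-foldr-⊔ f x∈xs) (m≤n⊔m (f y) _)

foldr-⊔-≤ : ∀ {A : Set} (xs : List A) (f : A → ℕ) {b} → (∀ x → f x ≤ b) → foldr ℕ._⊔_ 0 (List.map f xs) ≤ b
foldr-⊔-≤ []       f f≤b = z≤n
foldr-⊔-≤ (x ∷ xs) f f≤b = ⊔-lub (f≤b x) (foldr-⊔-≤ xs f f≤b)

foldr-⊓-attained : ∀ {A : Set} (xs : List A) (f : A → ℕ) {z} →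
                   ∃[ x ] f x ≤ z → ∃[ x ] f x ≤ foldr ℕ._⊓_ z (List.map f xs)
foldr-⊓-attained []       f below-z = below-z
foldr-⊓-attained (x ∷ xs) f below-z with ⊓-sel (f x) (foldr ℕ._⊓_ _ (List.map f xs))
... | inj₁ ⊓≡fx   = x , ≤-reflexive (sym ⊓≡fx)
... | inj₂ ⊓≡rest = subst (λ y → ∃[ x ] f x ≤ y) (sym ⊓≡rest) (foldr-⊓-attained xs f below-z)

module _ {n : ℕ} where

  inDeg≡∑δ : ∀ (hs : List (Fin n)) w → inDeg hs w ≡ ∑[ h ∈ hs ] δ h w
  inDeg≡∑δ hs w = length-filterᵇ (λ h → does (h Fin.≟ w)) hs

  inDeg≤maxLoad : ∀ (hs : List (Fin n)) w → inDeg hs w ≤ maxLoad hs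
  inDeg≤maxLoad hs w = ≤-foldr-⊔ (inDeg hs) (∈-allFin w)

  maxLoad≤length : ∀ (hs : List (Fin n)) → maxLoad hs ≤ length hs
  maxLoad≤length hs = foldr-⊔-≤ (allFin n) (inDeg hs) (λ w → length-filter (T? ∘ λ h → does (h Fin.≟ w)) hs)

  length-heads : ∀ {T} (es : Vec (Fin n × Fin n) T) o → length (heads es o) ≡ T
  length-heads []       []       = refl
  length-heads (e ∷ es) (b ∷ o) = cong suc (length-heads es o)

  -- The fold in minMaxLoad starts from T, which bounds the maximum load of every orientation.
  minMaxLoad-attained : ∀ {T} (es : Vec (Fin n × Fin n) T) → ∃[ o ] maxLoad (heads es o) ≤ minMaxLoad es
  minMaxLoad-attained {T} es = foldr-⊓-attained (allVecs (true ∷ false ∷ []) T) (λ o → maxLoad (heads es o))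
    (Vec.replicate T true , ≤-trans (maxLoad≤length (heads es _)) (≤-reflexive (length-heads es _)))

  arrivalsWithin : ∀ {T} → (Fin n → Bool) → Vec (Fin n × Fin n) T → ℕ
  arrivalsWithin s es = ∑ᵛ es (λ e → 𝟙 (s (proj₁ e) ∧ s (proj₂ e)))

  arrivalsWithin≤headsWithin : ∀ (s : Fin n → Bool) {T} (es : Vec (Fin n × Fin n) T) o → arrivalsWithin s es ≤ ∑[ h ∈ heads es o ] 𝟙 (s h)
  arrivalsWithin≤headsWithin s []             []      = z≤n
  arrivalsWithin≤headsWithin s ((u , v) ∷ es) (b ∷ o) =
    +-mono-≤ (head-inside b) (arrivalsWithin≤headsWithin s es o)
    where
    head-inside : ∀ b → 𝟙 (s u ∧ s v) ≤ 𝟙 (s (if b then v else u))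
    head-inside true  = 𝟙[x∧y]≤𝟙y (s u) (s v)
    head-inside false = 𝟙[x∧y]≤𝟙x (s u) (s v)

  headsWithin≤∑inDeg : ∀ (s : Fin n → Bool) (ws : List (Fin n)) → (∀ x → T (s x) → x ∈ ws) →
                       ∀ hs → ∑[ h ∈ hs ] 𝟙 (s h) ≤ ∑ ws (inDeg hs)
  headsWithin≤∑inDeg s ws covers hs = begin
    ∑[ h ∈ hs ] 𝟙 (s h)               ≤⟨ ∑-mono-≤ hs counted ⟩
    ∑[ h ∈ hs ] ∑[ w ∈ ws ] δ h w     ≡⟨ ∑-comm hs ws δ ⟩
    ∑[ w ∈ ws ] ∑[ h ∈ hs ] δ h w     ≡⟨ ∑-cong ws (λ w → inDeg≡∑δ hs w) ⟨
    ∑ ws (inDeg hs)                   ∎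
    where
    open ≤-Reasoning
    counted : ∀ h → 𝟙 (s h) ≤ ∑[ w ∈ ws ] δ h w
    counted h with s h in sh≡true
    ... | false = z≤n
    ... | true  = subst (_≤ ∑[ w ∈ ws ] δ h w) (δ-refl h) (∈⇒≤∑ (δ h) (covers h (subst T (sym sh≡true) _)))

  arrivalsWithin≤length*minMaxLoad : ∀ (s : Fin n → Bool) (ws : List (Fin n)) → (∀ x → T (s x) → x ∈ ws) →
                                     ∀ {T} (es : Vec (Fin n × Fin n) T) → arrivalsWithin s es ≤ length ws * minMaxLoad es
  arrivalsWithin≤length*minMaxLoad s ws covers es with minMaxLoad-attained es
  ... | o , maxLoad≤minMaxLoad = begin
    arrivalsWithin s es                 ≤⟨ arrivalsWithin≤headsWithin s es o ⟩
    ∑[ h ∈ heads es o ] 𝟙 (s h)         ≤⟨ headsWithin≤∑inDeg s ws covers (heads es o) ⟩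
    ∑ ws (inDeg (heads es o))           ≤⟨ ∑-mono-≤ ws (inDeg≤maxLoad (heads es o)) ⟩
    ∑[ _ ∈ ws ] maxLoad (heads es o)    ≡⟨ ∑-const ws _ ⟩
    length ws * maxLoad (heads es o)    ≤⟨ *-monoʳ-≤ (length ws) maxLoad≤minMaxLoad ⟩
    length ws * minMaxLoad es           ∎
    where open ≤-Reasoning

  arrivalsWithin-map : ∀ (s : Fin n → Bool) {M T} (e : Fin M → Fin n × Fin n) (a : Vec (Fin M) T) →
    arrivalsWithin s (Vec.map e a) ≡ ∑ᵛ a (λ i → 𝟙 (s (proj₁ (e i)) ∧ s (proj₂ (e i))))
  arrivalsWithin-map s e a = trans (cong (λ l → ∑[ p ∈ l ] 𝟙 (s (proj₁ p) ∧ s (proj₂ p))) (toList-map e a))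
                                   (∑-map (Vec.toList a) e _)

  occurrences≤2*minMaxLoad : ∀ {M T} (e : Fin M → Fin n × Fin n) x (a : Vec (Fin M) T) →
                             occurrences x a ≤ 2 * minMaxLoad (Vec.map e a)
  occurrences≤2*minMaxLoad e x a = begin
    occurrences x a                                              ≤⟨ ∑-mono-≤ (Vec.toList a) occurrence-inside ⟩
    ∑ᵛ a (λ i → 𝟙 (s (proj₁ (e i)) ∧ s (proj₂ (e i))))           ≡⟨ arrivalsWithin-map s e a ⟨
    arrivalsWithin s (Vec.map e a)                               ≤⟨ arrivalsWithin≤length*minMaxLoad s (u ∷ v ∷ []) covers (Vec.map e a) ⟩
    2 * minMaxLoad (Vec.map e a)                                 ∎
    where
    open ≤-Reasoning
    u = proj₁ (e x)
    v = proj₂ (e x)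
    s : Fin n → Bool
    s w = does (w Fin.≟ u) ∨ does (w Fin.≟ v)
    covers : ∀ w → T (s w) → w ∈ u ∷ v ∷ []
    covers w sw with w Fin.≟ u | w Fin.≟ v
    ... | yes refl | _        = here refl
    ... | no _     | yes refl = there (here refl)
    occurrence-inside : ∀ i → δ i x ≤ 𝟙 (s (proj₁ (e i)) ∧ s (proj₂ (e i)))
    occurrence-inside i with i Fin.≟ x
    ... | no _     = z≤n
    ... | yes refl = ≤-reflexive (cong 𝟙 (sym (cong₂ _∧_ su≡true sv≡true)))
      where
      su≡true : s u ≡ true
      su≡true = cong (_∨ does (u Fin.≟ v)) (dec-true (u Fin.≟ u) refl)
      sv≡true : s v ≡ true
      sv≡true = trans (cong (does (v Fin.≟ u) ∨_) (dec-true (v Fin.≟ v) refl)) (∨-zeroʳ (does (v Fin.≟ u)))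

frac-toℚᵘ : ∀ a b .{{_ : NonZero b}} → ℚ.toℚᵘ (frac a b) ℚᵘ.≃ mkℚᵘ (ℤ.+ a) (ℕ.pred b)
frac-toℚᵘ a (suc b) = toℚᵘ-fromℚᵘ (mkℚᵘ (ℤ.+ a) b)

frac*frac-toℚᵘ : ∀ a b c d .{{_ : NonZero b}} .{{_ : NonZero d}} →
                 ℚ.toℚᵘ (frac a b ℚ.* frac c d) ℚᵘ.≃ mkℚᵘ (ℤ.+ a) (ℕ.pred b) ℚᵘ.* mkℚᵘ (ℤ.+ c) (ℕ.pred d)
frac*frac-toℚᵘ a b c d = ℚᵘP.≃-trans (toℚᵘ-homo-* (frac a b) (frac c d)) (ℚᵘP.*-cong (frac-toℚᵘ a b) (frac-toℚᵘ c d))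

frac*frac≤frac*frac : ∀ a b c d e f g h .{{_ : NonZero b}} .{{_ : NonZero d}} .{{_ : NonZero f}} .{{_ : NonZero h}} →
  a * c * (f * h) ≤ e * g * (b * d) → frac a b ℚ.* frac c d ℚ.≤ frac e f ℚ.* frac g h
frac*frac≤frac*frac a b@(suc _) c d@(suc _) e f@(suc _) g h@(suc _) cross = toℚᵘ-cancel-≤
  (ℚᵘP.≤-respˡ-≃ (ℚᵘP.≃-sym (frac*frac-toℚᵘ a b c d)) (ℚᵘP.≤-respʳ-≃ (ℚᵘP.≃-sym (frac*frac-toℚᵘ e f g h))
    (ℚᵘ.*≤* (subst₂ ℤ._≤_ (as-ℤ a c (f * h)) (as-ℤ e g (b * d)) (ℤ.+≤+ cross)))))
  where
  as-ℤ : ∀ x y z → ℤ.+ (x * y * z) ≡ ℤ.+ x ℤ.* ℤ.+ y ℤ.* ℤ.+ z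
  as-ℤ x y z = trans (pos-* (x * y) z) (cong (ℤ._* ℤ.+ z) (pos-* x y))

frac≤frac⇒*≤* : ∀ a b c d .{{_ : NonZero b}} .{{_ : NonZero d}} → frac a b ℚ.≤ frac c d → a * d ≤ c * b
frac≤frac⇒*≤* a b@(suc _) c d@(suc _) a/b≤c/d
  with ℚᵘP.≤-respʳ-≃ (frac-toℚᵘ c d) (ℚᵘP.≤-respˡ-≃ (frac-toℚᵘ a b) (toℚᵘ-mono-≤ a/b≤c/d))
... | ℚᵘ.*≤* cross with subst₂ ℤ._≤_ (sym (pos-* a d)) (sym (pos-* c b)) cross
...   | ℤ.+≤+ a*d≤c*b = a*d≤c*b

foldr-⊔-preserves : ∀ {A : Set} (P : ℚ → Set) (f : A → ℚ) {z} xs →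
                    P z → (∀ x → P (f x)) → P (foldr ℚ._⊔_ z (List.map f xs))
foldr-⊔-preserves P f []       Pz Pf = Pz
foldr-⊔-preserves P f (x ∷ xs) Pz Pf with ℚP.⊔-sel (f x) (foldr ℚ._⊔_ _ (List.map f xs))
... | inj₁ ⊔≡fx   = subst P (sym ⊔≡fx) (Pf x)
... | inj₂ ⊔≡rest = subst P (sym ⊔≡rest) (foldr-⊔-preserves P f xs Pz Pf)

2*frac≤frac*frac : ∀ e s L P d n .{{_ : NonZero P}} .{{_ : NonZero n}} →
  2 * e * (P * n) ≤ L * d * s → frac 2 1 ℚ.* frac e s ℚ.≤ frac L P ℚ.* frac d n
-- frac e 0 is 0ℚ.
2*frac≤frac*frac e zero      L P d n _     = frac*frac≤frac*frac 2 1 0 1 L P d n z≤n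
2*frac≤frac*frac e s@(suc _) L P d n cross =
  frac*frac≤frac*frac 2 1 e s L P d n (subst (λ t → 2 * e * (P * n) ≤ L * d * t) (sym (*-identityˡ s)) cross)

dav-empty : (G : Graph 0) → ¬ (1ℚ ℚ.≤ dav G)
dav-empty G (ℚ.*≤* (ℤ.+≤+ ()))

1≤dav⇒n≤2*numE : ∀ {n} (G : Graph (suc n)) → 1ℚ ℚ.≤ dav G → suc n ≤ 2 * numE G
1≤dav⇒n≤2*numE {n} G 1≤dav =
  subst₂ _≤_ (+-identityʳ (suc n)) (*-identityʳ (2 * numE G)) (frac≤frac⇒*≤* 1 1 (2 * numE G) (suc n) 1≤dav)

n≤2*M⇒M≢0 : ∀ {n M} → suc n ≤ 2 * M → NonZero M
n≤2*M⇒M≢0 {M = suc _} _ = _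

-- The density bound

arrivals : ∀ {n T} (G : Graph n) → Vec (Fin (numE G)) T → Vec (Fin n × Fin n) T
arrivals G a = Vec.map (List.lookup (edges G)) a

loadSum : ∀ {n} (G : Graph n) → ℕ → ℕ
loadSum G T = ∑[ a ∈ allVecs (allFin (numE G)) T ] minMaxLoad (arrivals G a)

∑-lookup-allFin : ∀ {n} (S : Vec Bool n) → ∑[ i ∈ allFin n ] 𝟙 (Vec.lookup S i) ≡ ∑[ b ∈ Vec.toList S ] 𝟙 b
∑-lookup-allFin []      = refl
∑-lookup-allFin (b ∷ S) = trans (∑-allFin-suc _ (𝟙 ∘ Vec.lookup (b ∷ S))) (cong (𝟙 b +_) (∑-lookup-allFin S))

length-members≡size : ∀ {n} (S : Vec Bool n) → length (filterᵇ (Vec.lookup S) (allFin n)) ≡ size S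
length-members≡size {n} S = begin
  length (filterᵇ (Vec.lookup S) (allFin n))   ≡⟨ length-filterᵇ (Vec.lookup S) (allFin n) ⟩
  ∑[ i ∈ allFin n ] 𝟙 (Vec.lookup S i)         ≡⟨ ∑-lookup-allFin S ⟩
  ∑[ b ∈ Vec.toList S ] 𝟙 b                    ≡⟨ length-filterᵇ (λ b → b) (Vec.toList S) ⟨
  size S                                       ∎
  where open ≡-Reasoning

module _ {n} (G : Graph n) where

  private
    M = numE G

  M*∑arrivalsWithin≡ : ∀ T (s : Fin n → Bool) →
    M * (∑[ a ∈ allVecs (allFin M) T ] arrivalsWithin s (arrivals G a)) ≡ T * M ^ T * (∑[ p ∈ edges G ] 𝟙 (s (proj₁ p) ∧ s (proj₂ p)))
  M*∑arrivalsWithin≡ T s = begin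
    M * (∑[ a ∈ allVecs (allFin M) T ] arrivalsWithin s (arrivals G a))
      ≡⟨ cong (M *_) (∑-cong (allVecs (allFin M) T) (arrivalsWithin-map s (List.lookup (edges G)))) ⟩
    M * (∑[ a ∈ allVecs (allFin M) T ] ∑ᵛ a inside)
      ≡⟨ cong (_* (∑[ a ∈ allVecs (allFin M) T ] ∑ᵛ a inside)) (length-allFin M) ⟨
    length (allFin M) * (∑[ a ∈ allVecs (allFin M) T ] ∑ᵛ a inside)
      ≡⟨ ∑-allVecs-additive (allFin M) T inside ⟩
    T * length (allFin M) ^ T * ∑ (allFin M) inside
      ≡⟨ cong₂ (λ l s → T * l ^ T * s) (length-allFin M) (∑-lookup (edges G) (λ p → 𝟙 (s (proj₁ p) ∧ s (proj₂ p)))) ⟩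
    T * M ^ T * (∑[ p ∈ edges G ] 𝟙 (s (proj₁ p) ∧ s (proj₂ p)))
      ∎
    where
    open ≡-Reasoning
    inside : Fin M → ℕ
    inside i = 𝟙 (s (proj₁ (List.lookup (edges G) i)) ∧ s (proj₂ (List.lookup (edges G) i)))

  t*M^t*edgesIn≤M*size*loadSum : ∀ t (S : Vec Bool n) → t * M ^ t * edgesIn G S ≤ M * (size S * loadSum G t)
  t*M^t*edgesIn≤M*size*loadSum t S = begin
    t * M ^ t * edgesIn G S
      ≡⟨ cong (t * M ^ t *_) (length-filterᵇ _ (edges G)) ⟩
    t * M ^ t * (∑[ p ∈ edges G ] 𝟙 (s (proj₁ p) ∧ s (proj₂ p)))
      ≡⟨ M*∑arrivalsWithin≡ t s ⟨
    M * (∑[ a ∈ allVecs (allFin M) t ] arrivalsWithin s (arrivals G a))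
      ≤⟨ *-monoʳ-≤ M (∑-mono-≤ (allVecs (allFin M) t) (λ a → arrivalsWithin≤length*minMaxLoad s members covers (arrivals G a))) ⟩
    M * (∑[ a ∈ allVecs (allFin M) t ] length members * minMaxLoad (arrivals G a))
      ≡⟨ cong (M *_) (∑-*ˡ (allVecs (allFin M) t) (length members) _) ⟩
    M * (length members * loadSum G t)
      ≡⟨ cong (λ l → M * (l * loadSum G t)) (length-members≡size S) ⟩
    M * (size S * loadSum G t)
      ∎
    where
    open ≤-Reasoning
    s = Vec.lookup S
    members = filterᵇ s (allFin n)
    covers : ∀ x → T (s x) → x ∈ members
    covers x sx = ∈-filter⁺ (T? ∘ s) (∈-allFin x) sx

2ρ*≤OPT*dav : ∀ {n} (G : Graph n) → 1ℚ ℚ.≤ dav G → frac 2 1 ℚ.* rhoStar G ℚ.≤ OPT G n ℚ.* dav G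
2ρ*≤OPT*dav {zero}  G 1≤dav = ⊥-elim (dav-empty G 1≤dav)
2ρ*≤OPT*dav {suc n} G 1≤dav =
  foldr-⊔-preserves (λ q → frac 2 1 ℚ.* q ℚ.≤ OPT G (suc n) ℚ.* dav G) (rho G)
    (filterᵇ nonempty (allVecs (true ∷ false ∷ []) (suc n))) 2*0ℚ≤ twice-ρ≤
  where
  M = numE G
  L = loadSum G (suc n)
  instance
    M≢0 : NonZero M
    M≢0 = n≤2*M⇒M≢0 (1≤dav⇒n≤2*numE G 1≤dav)
    M^n≢0 : NonZero (M ^ suc n)
    M^n≢0 = m^n≢0 M (suc n)
  2*0ℚ≤ : frac 2 1 ℚ.* 0ℚ ℚ.≤ frac L (M ^ suc n) ℚ.* frac (2 * M) (suc n)
  2*0ℚ≤ = 2*frac≤frac*frac 0 0 L (M ^ suc n) (2 * M) (suc n) z≤n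
  twice-ρ≤ : ∀ S → frac 2 1 ℚ.* frac (edgesIn G S) (size S) ℚ.≤ frac L (M ^ suc n) ℚ.* frac (2 * M) (suc n)
  twice-ρ≤ S = 2*frac≤frac*frac (edgesIn G S) (size S) L (M ^ suc n) (2 * M) (suc n) (begin
    2 * edgesIn G S * (M ^ suc n * suc n)   ≡⟨ lhs (edgesIn G S) (M ^ suc n) (suc n) ⟩
    2 * (suc n * M ^ suc n * edgesIn G S)   ≤⟨ *-monoʳ-≤ 2 (t*M^t*edgesIn≤M*size*loadSum G (suc n) S) ⟩
    2 * (M * (size S * L))                  ≡⟨ rhs M (size S) L ⟩
    L * (2 * M) * size S                    ∎)
    where
    open ≤-Reasoning
    lhs : ∀ e P n → 2 * e * (P * n) ≡ 2 * (n * P * e)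
    lhs = solve 3 (λ e P n → con 2 :* e :* (P :* n) := con 2 :* (n :* P :* e)) refl
    rhs : ∀ M s L → 2 * (M * (s * L)) ≡ L * (2 * M) * s
    rhs = solve 3 (λ M s L → con 2 :* (M :* (s :* L)) := L :* (con 2 :* M) :* s) refl


-- Logarithms and the choice of blocks

*≤⇒≤/ : ∀ a b d .{{_ : NonZero d}} → a * d ≤ b → a ≤ b / d
*≤⇒≤/ a b d a*d≤b = subst (_≤ b / d) (m*n/n≡m a d) (/-monoˡ-≤ d a*d≤b)

<[1+/]* : ∀ b d .{{_ : NonZero d}} → b < suc (b / d) * d
<[1+/]* b d = begin-strict
  b                  ≡⟨ m≡m%n+[m/n]*n b d ⟩
  b % d + b / d * d  <⟨ +-monoˡ-< (b / d * d) (m%n<n b d) ⟩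
  d + b / d * d      ∎
  where open ≤-Reasoning

2*⌊n/2⌋≤n : ∀ n → 2 * ⌊ n /2⌋ ≤ n
2*⌊n/2⌋≤n n = begin
  ⌊ n /2⌋ + (⌊ n /2⌋ + 0)  ≡⟨ cong (⌊ n /2⌋ +_) (+-identityʳ _) ⟩
  ⌊ n /2⌋ + ⌊ n /2⌋        ≤⟨ +-monoʳ-≤ ⌊ n /2⌋ (⌊n/2⌋≤⌈n/2⌉ n) ⟩
  ⌊ n /2⌋ + ⌈ n /2⌉        ≡⟨ ⌊n/2⌋+⌈n/2⌉≡n n ⟩
  n                        ∎
  where open ≤-Reasoning

2^⌊log2⌋≤n : ∀ n (rec : Acc _<_ (suc n)) → 2 ^ ⌊log2⌋ (suc n) rec ≤ suc n
2^⌊log2⌋≤n zero    _         = ≤-refl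
2^⌊log2⌋≤n (suc n) (acc rec) = begin
  2 * 2 ^ ⌊log2⌋ (suc ⌊ n /2⌋) _  ≤⟨ *-monoʳ-≤ 2 (2^⌊log2⌋≤n ⌊ n /2⌋ _) ⟩
  2 * suc ⌊ n /2⌋                 ≡⟨ *-suc 2 ⌊ n /2⌋ ⟩
  2 + 2 * ⌊ n /2⌋                 ≤⟨ +-monoʳ-≤ 2 (2*⌊n/2⌋≤n n) ⟩
  2 + n                           ∎
  where open ≤-Reasoning

2^⌊log₂n⌋≤n : ∀ n .{{_ : NonZero n}} → 2 ^ ⌊log₂ n ⌋ ≤ n
2^⌊log₂n⌋≤n (suc n) = 2^⌊log2⌋≤n n _

n<2^[1+⌊log₂n⌋] : ∀ n → n < 2 ^ suc ⌊log₂ n ⌋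
n<2^[1+⌊log₂n⌋] n with 2 ^ suc ⌊log₂ n ⌋ ≤? n
... | no  2^[1+log]≰n = ≰⇒> 2^[1+log]≰n
... | yes 2^[1+log]≤n = ⊥-elim (1+n≰n (begin
  suc ⌊log₂ n ⌋              ≡⟨ ⌊log₂[2^n]⌋≡n (suc ⌊log₂ n ⌋) ⟨
  ⌊log₂ 2 ^ suc ⌊log₂ n ⌋ ⌋  ≤⟨ ⌊log₂⌋-mono-≤ 2^[1+log]≤n ⟩
  ⌊log₂ n ⌋                  ∎))
  where open ≤-Reasoning

n<2^n : ∀ n → n < 2 ^ n
n<2^n zero    = s≤s z≤n
n<2^n (suc n) = begin-strict
  1 + n              <⟨ +-mono-≤-< (m^n>0 2 n) (n<2^n n) ⟩
  2 ^ n + 2 ^ n      ≡⟨ cong (2 ^ n +_) (+-identityʳ (2 ^ n)) ⟨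
  2 ^ suc n          ∎
  where open ≤-Reasoning

[6k]^k*2^[D*k]≤2^Lg : ∀ k D Lg → 1 ≤ D → k < 2 ^ suc D → 6 * D * k ≤ Lg → (6 * k) ^ k * 2 ^ (D * k) ≤ 2 ^ Lg
[6k]^k*2^[D*k]≤2^Lg k D Lg 1≤D k<2^[1+D] 6Dk≤Lg = begin
  (6 * k) ^ k * 2 ^ (D * k)              ≤⟨ *-monoˡ-≤ (2 ^ (D * k)) (^-monoˡ-≤ k 6k≤2^[4+D]) ⟩
  (2 ^ (4 + D)) ^ k * 2 ^ (D * k)        ≡⟨ cong (_* 2 ^ (D * k)) (^-*-assoc 2 (4 + D) k) ⟩
  2 ^ ((4 + D) * k) * 2 ^ (D * k)        ≡⟨ ^-distribˡ-+-* 2 ((4 + D) * k) (D * k) ⟨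
  2 ^ ((4 + D) * k + D * k)              ≤⟨ ^-monoʳ-≤ 2 exponent≤Lg ⟩
  2 ^ Lg                                 ∎
  where
  open ≤-Reasoning
  6k≤2^[4+D] : 6 * k ≤ 2 ^ (4 + D)
  6k≤2^[4+D] = begin
    6 * k                ≤⟨ *-monoʳ-≤ 6 (<⇒≤ k<2^[1+D]) ⟩
    6 * 2 ^ suc D        ≤⟨ *-monoˡ-≤ (2 ^ suc D) (m≤m+n 6 2) ⟩
    8 * 2 ^ suc D        ≡⟨ 8*x≡2*[2*[2*x]] (2 ^ suc D) ⟩
    2 ^ (4 + D)          ∎
    where
    8*x≡2*[2*[2*x]] : ∀ x → 8 * x ≡ 2 * (2 * (2 * x))
    8*x≡2*[2*[2*x]] = solve 1 (λ x → con 8 :* x := con 2 :* (con 2 :* (con 2 :* x))) refl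
  exponent≤Lg : (4 + D) * k + D * k ≤ Lg
  exponent≤Lg = begin
    (4 + D) * k + D * k    ≡⟨ split D k ⟩
    4 * k + 2 * D * k      ≤⟨ +-monoˡ-≤ (2 * D * k) (*-monoˡ-≤ k (*-monoʳ-≤ 4 1≤D)) ⟩
    4 * D * k + 2 * D * k  ≡⟨ merge D k ⟩
    6 * D * k              ≤⟨ 6Dk≤Lg ⟩
    Lg                     ∎
    where
    split : ∀ D k → (4 + D) * k + D * k ≡ 4 * k + 2 * D * k
    split = solve 2 (λ D k → (con 4 :+ D) :* k :+ D :* k := con 4 :* k :+ con 2 :* D :* k) refl
    merge : ∀ D k → 4 * D * k + 2 * D * k ≡ 6 * D * k
    merge = solve 2 (λ D k → con 4 :* D :* k :+ con 2 :* D :* k := con 6 :* D :* k) refl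

3^k*M^k′≤m^k : ∀ M m n k′ D → M ≤ n * 2 ^ D → n ≤ 2 * suc k′ * m → (6 * suc k′) ^ suc k′ * 2 ^ (D * suc k′) ≤ n →
               3 ^ suc k′ * M ^ k′ ≤ m ^ suc k′
3^k*M^k′≤m^k M m n k′ D M≤n*2^D n≤2km [6k]^k*2^[Dk]≤n = *-cancelʳ-≤ (3 ^ k * M ^ k′) (m ^ k) ((2 * k) ^ k) {{m^n≢0 (2 * k) k}} (begin
  3 ^ k * M ^ k′ * (2 * k) ^ k                ≡⟨ xy∙z≈xz∙y (3 ^ k) (M ^ k′) ((2 * k) ^ k) ⟩
  3 ^ k * (2 * k) ^ k * M ^ k′                ≡⟨ cong (_* M ^ k′) (trans (cong (_^ k) (sym (3*[2*k]≡6*k k))) (^-distrib-* 3 (2 * k) k)) ⟨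
  (6 * k) ^ k * M ^ k′                        ≤⟨ *-monoʳ-≤ ((6 * k) ^ k) (^-monoˡ-≤ k′ M≤n*2^D) ⟩
  (6 * k) ^ k * (n * 2 ^ D) ^ k′              ≡⟨ cong ((6 * k) ^ k *_) (trans (^-distrib-* n (2 ^ D) k′) (cong (n ^ k′ *_) (^-*-assoc 2 D k′))) ⟩
  (6 * k) ^ k * (n ^ k′ * 2 ^ (D * k′))       ≤⟨ *-monoʳ-≤ ((6 * k) ^ k) (*-monoʳ-≤ (n ^ k′) (^-monoʳ-≤ 2 (*-monoʳ-≤ D (n≤1+n k′)))) ⟩
  (6 * k) ^ k * (n ^ k′ * 2 ^ (D * k))        ≡⟨ x∙yz≈xz∙y ((6 * k) ^ k) (n ^ k′) (2 ^ (D * k)) ⟩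
  (6 * k) ^ k * 2 ^ (D * k) * n ^ k′          ≤⟨ *-monoˡ-≤ (n ^ k′) [6k]^k*2^[Dk]≤n ⟩
  n ^ k                                       ≤⟨ ^-monoˡ-≤ k n≤2km ⟩
  (2 * k * m) ^ k                             ≡⟨ trans (^-distrib-* (2 * k) m k) (*-comm ((2 * k) ^ k) (m ^ k)) ⟩
  m ^ k * (2 * k) ^ k                         ∎)
  where
  open ≤-Reasoning
  k = suc k′
  3*[2*k]≡6*k : ∀ k → 3 * (2 * k) ≡ 6 * k
  3*[2*k]≡6*k = solve 1 (λ k → con 3 :* (con 2 :* k) := con 6 :* k) refl

[M+m]^k≤M*m^k : ∀ M m k′ → m ≤ 2 * M → 3 ^ suc k′ * M ^ k′ ≤ m ^ suc k′ → (M + m) ^ suc k′ ≤ M * m ^ suc k′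
[M+m]^k≤M*m^k M m k′ m≤2M 3^k*M^k′≤m^k = begin
  (M + m) ^ suc k′              ≤⟨ ^-monoˡ-≤ (suc k′) (+-monoʳ-≤ M m≤2M) ⟩
  (M + 2 * M) ^ suc k′          ≡⟨ cong (_^ suc k′) (M+2*M≡3*M M) ⟩
  (3 * M) ^ suc k′              ≡⟨ ^-distrib-* 3 M (suc k′) ⟩
  3 ^ suc k′ * (M * M ^ k′)     ≡⟨ x∙yz≈y∙xz (3 ^ suc k′) M (M ^ k′) ⟩
  M * (3 ^ suc k′ * M ^ k′)     ≤⟨ *-monoʳ-≤ M 3^k*M^k′≤m^k ⟩
  M * m ^ suc k′                ∎
  where
  open ≤-Reasoning
  M+2*M≡3*M : ∀ M → M + 2 * M ≡ 3 * M
  M+2*M≡3*M = solve 1 (λ M → M :+ con 2 :* M := con 3 :* M) refl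

record BlockChoice (n M Lg D : ℕ) : Set where
  field
    k m r        : ℕ
    n≡k*m+r      : n ≡ k * m + r
    0<m          : 0 < m
    many-repeats : (M + m) ^ k ≤ M * m ^ k
    Lg≤12*D*k    : Lg ≤ 12 * D * k

-- For M = numE G, Lg and D unfold to lg n and logDavLog G.
module LogScales (n M : ℕ) .{{_ : NonZero n}} (4≤n : 4 ≤ n) (n≤2M : n ≤ 2 * M) where

  Lg X D : ℕ
  Lg = ⌊log₂ n ⌋
  X  = 2 * M * Lg / n
  D  = ⌊log₂ X ⌋

  2≤Lg : 2 ≤ Lg
  2≤Lg = ⌊log₂⌋-mono-≤ 4≤n

  2^Lg≤n : 2 ^ Lg ≤ n
  2^Lg≤n = 2^⌊log₂n⌋≤n n

  Lg≤X : Lg ≤ X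
  Lg≤X = *≤⇒≤/ Lg (2 * M * Lg) n (≤-trans (≤-reflexive (*-comm Lg n)) (*-monoˡ-≤ Lg n≤2M))

  X<2^[1+D] : X < 2 ^ suc D
  X<2^[1+D] = n<2^[1+⌊log₂n⌋] X

  1≤D : 1 ≤ D
  1≤D with D in D≡
  ... | suc _ = s≤s z≤n
  ... | zero  = ⊥-elim (<⇒≱ (subst (λ d → X < 2 ^ suc d) D≡ X<2^[1+D]) (≤-trans 2≤Lg Lg≤X))

  M≤n*2^D : M ≤ n * 2 ^ D
  M≤n*2^D = *-cancelˡ-≤ 2 (<⇒≤ (begin-strict
    2 * M               ≤⟨ m≤m*n (2 * M) Lg {{ℕ.>-nonZero (≤-trans (s≤s z≤n) 2≤Lg)}} ⟩
    2 * M * Lg          <⟨ <[1+/]* (2 * M * Lg) n ⟩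
    suc X * n           ≤⟨ *-monoˡ-≤ n X<2^[1+D] ⟩
    2 ^ suc D * n       ≡⟨ regroup (2 ^ D) n ⟩
    2 * (n * 2 ^ D)     ∎))
    where
    open ≤-Reasoning
    regroup : ∀ p n → 2 * p * n ≡ 2 * (n * p)
    regroup = solve 2 (λ p n → con 2 :* p :* n := con 2 :* (n :* p)) refl

  instance
    6*D≢0 : NonZero (6 * D)
    6*D≢0 = ℕ.>-nonZero (≤-trans 1≤D (m≤n*m D 6))

  module Blocking (k′ : ℕ) (k*6D≤Lg : suc k′ * (6 * D) ≤ Lg) (Lg<[1+k]*6D : Lg < suc (suc k′) * (6 * D)) where

    k m r : ℕ
    k = suc k′
    m = n / k
    r = n % k

    k≤Lg : k ≤ Lg
    k≤Lg = ≤-trans (m≤m*n k (6 * D)) k*6D≤Lg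

    k≤n : k ≤ n
    k≤n = ≤-trans k≤Lg (≤-trans (<⇒≤ (n<2^n Lg)) 2^Lg≤n)

    0<m : 0 < m
    0<m = m≥n⇒m/n>0 k≤n

    m≤2M : m ≤ 2 * M
    m≤2M = ≤-trans (m/n≤m n k) n≤2M

    n≤2km : n ≤ 2 * k * m
    n≤2km = <⇒≤ (begin-strict
      n              <⟨ <[1+/]* n k ⟩
      k + m * k      ≤⟨ +-monoˡ-≤ (m * k) (subst (_≤ m * k) (*-identityˡ k) (*-monoˡ-≤ k 0<m)) ⟩
      m * k + m * k  ≡⟨ double m k ⟩
      2 * k * m      ∎)
      where
      open ≤-Reasoning
      double : ∀ m k → m * k + m * k ≡ 2 * k * m
      double = solve 2 (λ m k → m :* k :+ m :* k := con 2 :* k :* m) refl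

    k<2^[1+D] : k < 2 ^ suc D
    k<2^[1+D] = ≤-<-trans (≤-trans k≤Lg Lg≤X) X<2^[1+D]

    6Dk≤Lg : 6 * D * k ≤ Lg
    6Dk≤Lg = ≤-trans (≤-reflexive (*-comm (6 * D) k)) k*6D≤Lg

    Lg≤12*D*k : Lg ≤ 12 * D * k
    Lg≤12*D*k = <⇒≤ (begin-strict
      Lg                          <⟨ Lg<[1+k]*6D ⟩
      6 * D + k * (6 * D)         ≤⟨ +-monoˡ-≤ (k * (6 * D)) (m≤n*m (6 * D) k) ⟩
      k * (6 * D) + k * (6 * D)   ≡⟨ double k D ⟩
      12 * D * k                  ∎)
      where
      open ≤-Reasoning
      double : ∀ k D → k * (6 * D) + k * (6 * D) ≡ 12 * D * k
      double = solve 2 (λ k D → k :* (con 6 :* D) :+ k :* (con 6 :* D) := con 12 :* D :* k) refl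

    choice : BlockChoice n M Lg D
    choice = record
      { k = k ; m = m ; r = r
      ; n≡k*m+r      = trans (m≡m%n+[m/n]*n n k) (trans (+-comm r (m * k)) (cong (_+ r) (*-comm m k)))
      ; 0<m          = 0<m
      ; many-repeats = [M+m]^k≤M*m^k M m k′ m≤2M (3^k*M^k′≤m^k M m n k′ D M≤n*2^D n≤2km
                         (≤-trans ([6k]^k*2^[D*k]≤2^Lg k D Lg 1≤D k<2^[1+D] 6Dk≤Lg) 2^Lg≤n))
      ; Lg≤12*D*k    = Lg≤12*D*k
      }

  choose-blocks : Lg ≤ 12 * D ⊎ BlockChoice n M Lg D
  choose-blocks with Lg ≤? 12 * D
  ... | yes Lg≤12D = inj₁ Lg≤12D
  ... | no  Lg≰12D with Lg / (6 * D) in k≡ | m/n*n≤m Lg (6 * D) | <[1+/]* Lg (6 * D)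
  ...   | suc k′ | k*6D≤Lg | Lg<[1+k]*6D = inj₂ (Blocking.choice k′ k*6D≤Lg Lg<[1+k]*6D)
  ...   | zero   | _       | _            = ⊥-elim (<⇒≱ (subst (0 <_) k≡ (m≥n⇒m/n>0 6D≤Lg)) z≤n)
    where
    6D≤Lg : 6 * D ≤ Lg
    6D≤Lg = ≤-trans (*-monoˡ-≤ D (m≤m+n 6 6)) (<⇒≤ (≰⇒> Lg≰12D))

-- The logarithmic bound

0<minMaxLoad : ∀ {n M T} (e : Fin M → Fin n × Fin n) (a : Vec (Fin M) (suc T)) → 0 < minMaxLoad (Vec.map e a)
0<minMaxLoad e (x ∷ a) = 0<m*n⇒0<n 2 (<-≤-trans 0<occurrences (occurrences≤2*minMaxLoad e x (x ∷ a)))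
  where
  0<occurrences : 0 < occurrences x (x ∷ a)
  0<occurrences = subst (λ d → 0 < d + occurrences x a) (sym (δ-refl x)) (s≤s z≤n)

M^[1+t]≤loadSum : ∀ {n} (G : Graph n) t → numE G ^ suc t ≤ loadSum G (suc t)
M^[1+t]≤loadSum G t = begin
  numE G ^ suc t                                              ≡⟨ cong (_^ suc t) (length-allFin (numE G)) ⟨
  length (allFin (numE G)) ^ suc t                            ≡⟨ *-identityʳ _ ⟨
  length (allFin (numE G)) ^ suc t * 1                        ≡⟨ ∑-allVecs-const (allFin (numE G)) (suc t) 1 ⟨
  ∑[ _ ∈ allVecs (allFin (numE G)) (suc t) ] 1                ≤⟨ ∑-mono-≤ (allVecs (allFin (numE G)) (suc t)) (0<minMaxLoad (List.lookup (edges G))) ⟩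
  loadSum G (suc t)                                           ∎
  where open ≤-Reasoning

k*M^[k*m+r]≤4*∑minMaxLoad : ∀ {n M} (e : Fin M → Fin n × Fin n) m r k .{{_ : NonZero M}} .{{_ : NonZero m}} →
  (M + m) ^ k ≤ M * m ^ k → k * M ^ (k * m + r) ≤ 4 * (∑[ a ∈ allVecs (allFin M) (k * m + r) ] minMaxLoad (Vec.map e a))
k*M^[k*m+r]≤4*∑minMaxLoad {M = M} e m r k many-repeats =
  subst (λ L → k * M ^ L ≤ 4 * (∑[ a ∈ allVecs (allFin M) L ] minMaxLoad (Vec.map e a))) (blocksLength≡ k) (begin
    k * M ^ L                                            ≤⟨ *-monoʳ-≤ k (M^L≤2*#[Z>0] many-repeats) ⟩
    k * (2 * (∑[ a ∈ sequences ] 𝟙 (0 <ᵇ Z a)))          ≡⟨ x∙yz≈y∙xz k 2 _ ⟩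
    2 * (k * (∑[ a ∈ sequences ] 𝟙 (0 <ᵇ Z a)))          ≡⟨ cong (2 *_) (∑-*ˡ sequences k _) ⟨
    2 * (∑[ a ∈ sequences ] k * 𝟙 (0 <ᵇ Z a))            ≤⟨ *-monoʳ-≤ 2 (∑-mono-≤ sequences repeated-edge) ⟩
    2 * (∑[ a ∈ sequences ] 2 * minMaxLoad (Vec.map e a)) ≡⟨ cong (2 *_) (∑-*ˡ sequences 2 (λ a → minMaxLoad (Vec.map e a))) ⟩
    2 * (2 * (∑[ a ∈ sequences ] minMaxLoad (Vec.map e a))) ≡⟨ *-assoc 2 2 (∑[ a ∈ sequences ] minMaxLoad (Vec.map e a)) ⟨
    4 * (∑[ a ∈ sequences ] minMaxLoad (Vec.map e a))     ∎)
  where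
  open Blocks {Fin M} m r using (blocksLength≡; blockProduct; 0<blockProduct⇒k≤∑ᵛ)
  open SecondMoment M m r k
  open ≤-Reasoning
  repeated-edge : ∀ a → k * 𝟙 (0 <ᵇ Z a) ≤ 2 * minMaxLoad (Vec.map e a)
  repeated-edge a with Z a | ∑-positive (allFin M) (λ x → blockProduct (occurrences x) k a)
  ... | zero  | _        = subst (_≤ 2 * minMaxLoad (Vec.map e a)) (sym (*-zeroʳ k)) z≤n
  ... | suc _ | positive with positive (s≤s z≤n)
  ...   | x , 0<bp = begin
    k * 1                            ≡⟨ *-identityʳ k ⟩
    k                                ≤⟨ 0<blockProduct⇒k≤∑ᵛ (λ i → δ i x) k a 0<bp ⟩
    occurrences x a                  ≤⟨ occurrences≤2*minMaxLoad e x a ⟩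
    2 * minMaxLoad (Vec.map e a)     ∎

lg*M^n≤48*logDavLog*loadSum : ∀ {n} (G : Graph (suc n)) → 4 ≤ suc n → suc n ≤ 2 * numE G →
                              lg (suc n) * numE G ^ suc n ≤ 48 * logDavLog G * loadSum G (suc n)
lg*M^n≤48*logDavLog*loadSum {n} G 4≤n n≤2M = bound choose-blocks
  where
  M = numE G
  L = loadSum G (suc n)
  instance
    M≢0 : NonZero M
    M≢0 = n≤2*M⇒M≢0 n≤2M
  open LogScales (suc n) M 4≤n n≤2M
  open ≤-Reasoning

  bound : Lg ≤ 12 * D ⊎ BlockChoice (suc n) M Lg D → Lg * M ^ suc n ≤ 48 * D * L
  bound (inj₁ Lg≤12D) = begin
    Lg * M ^ suc n           ≤⟨ *-mono-≤ Lg≤12D (M^[1+t]≤loadSum G n) ⟩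
    12 * D * L               ≤⟨ *-monoˡ-≤ L (*-monoˡ-≤ D (m≤m+n 12 36)) ⟩
    48 * D * L               ∎
  bound (inj₂ choice) = begin
    Lg * M ^ suc n           ≤⟨ *-monoˡ-≤ (M ^ suc n) Lg≤12*D*k ⟩
    12 * D * k * M ^ suc n   ≡⟨ *-assoc (12 * D) k (M ^ suc n) ⟩
    12 * D * (k * M ^ suc n) ≤⟨ *-monoʳ-≤ (12 * D) k*M^n≤4*L ⟩
    12 * D * (4 * L)         ≡⟨ regroup D L ⟩
    48 * D * L               ∎
    where
    open BlockChoice choice
    k*M^n≤4*L : k * M ^ suc n ≤ 4 * L
    k*M^n≤4*L = subst (λ t → k * M ^ t ≤ 4 * loadSum G t) (sym n≡k*m+r)
      (k*M^[k*m+r]≤4*∑minMaxLoad (List.lookup (edges G)) m r k {{M≢0}} {{ℕ.>-nonZero 0<m}} many-repeats)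
    regroup : ∀ D L → 12 * D * (4 * L) ≡ 48 * D * L
    regroup = solve 2 (λ D L → con 12 :* D :* (con 4 :* L) := con 48 :* D :* L) refl

lg/48≤OPT*logDavLog : ∀ {n} → n ℕ.≥ 4 → (G : Graph n) → 1ℚ ℚ.≤ dav G →
                      frac 1 48 ℚ.* frac (lg n) 1 ℚ.≤ OPT G n ℚ.* frac (logDavLog G) 1
lg/48≤OPT*logDavLog {suc n} 4≤n G 1≤dav =
  frac*frac≤frac*frac 1 48 (lg (suc n)) 1 (loadSum G (suc n)) (M ^ suc n) (logDavLog G) 1 (begin
    1 * lg (suc n) * (M ^ suc n * 1)                     ≡⟨ trim (lg (suc n)) (M ^ suc n) ⟩
    lg (suc n) * M ^ suc n                               ≤⟨ lg*M^n≤48*logDavLog*loadSum G 4≤n n≤2M ⟩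
    48 * logDavLog G * loadSum G (suc n)                 ≡⟨ reorder (logDavLog G) (loadSum G (suc n)) ⟩
    loadSum G (suc n) * logDavLog G * (48 * 1)           ∎)
  where
  open ≤-Reasoning
  M = numE G
  n≤2M = 1≤dav⇒n≤2*numE G 1≤dav
  instance
    M^n≢0 : NonZero (M ^ suc n)
    M^n≢0 = m^n≢0 M (suc n) {{n≤2*M⇒M≢0 n≤2M}}
  trim : ∀ a b → 1 * a * (b * 1) ≡ a * b
  trim = solve 2 (λ a b → con 1 :* a :* (b :* con 1) := a :* b) refl
  reorder : ∀ D L → 48 * D * L ≡ L * D * (48 * 1)
  reorder = solve 2 (λ D L → con 48 :* D :* L := L :* D :* (con 48 :* con 1)) refl

claim2p3 : (∀ {n} (G : Graph n) → 1ℚ ℚ.≤ dav G →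
    frac 2 1 ℚ.* rhoStar G ℚ.≤ OPT G n ℚ.* dav G)
    ×
    Σ ℚ (λ c → (0ℚ ℚ.< c) × Σ ℕ (λ N → ∀ {n} → n ℕ.≥ N → (G : Graph n) → 1ℚ ℚ.≤ dav G →
    c ℚ.* frac (lg n) 1 ℚ.≤ OPT G n ℚ.* frac (logDavLog G) 1))
claim2p3 = 2ρ*≤OPT*dav , (frac 1 48 , ℚ.*<* (ℤ.+<+ (s≤s z≤n)) , 4 , lg/48≤OPT*logDavLog)
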